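{- For every matroid $M$: (1) the branch-depth of $M$ is at most $\mathrm{cdd}(M)$; (2) $\mathrm{cdd}(M)\le\min(\mathrm{cd}(M),\mathrm{dd}(M))$.
   Context: For a matroid $M$ with rank function $r$ on ground set $E$, the connectivity function is $\lambda_M(X)=r(X)+r(E\setminus X)-r(E)$. A decomposition of $\lambda_M$ is a pair $(T,\sigma)$ with $T$ a tree having at least one internal node and $\sigma$ a bijection from $E$ to the leaves of $T$; for an internal node $v$ the components of $T-v$ induce a partition $\mathcal P_v$ of $E$ and the width of $v$ is $\max_{\mathcal P'\subseteq\mathcal P_v}\lambda_M(\bigcup_{X\in\mathcal P'}X)$; the width of $(T,\sigma)$ is the maximum width of an internal node, and its radius is the minimum $r$ such that some node of $T$ is within distance $r$ of all nodes. The branch-depth of $M$ is the minimum $k$ such that there is a decomposition of width $\le k$ and radius $\le k$ (and $0$ if $|E|<2$). Contraction depth $\mathrm{cd}$, deletion depth $\mathrm{dd}$ and contraction-deletion depth $\mathrm{cdd}$ are defined recursively: all are $0$ if $E(M)=\emptyset$; if $M$ is disconnected each is the maximum of the respective depth over components; if $M$ is connected and nonempty, $\mathrm{cd}(M)$ is the minimum $k$ with $\mathrm{cd}(M/e)\le k-1$ for some $e$, $\mathrm{dd}(M)$ the minimum $k$ with $\mathrm{dd}(M\setminus e)\le k-1$ for some $e$, and $\mathrm{cdd}(M)$ the minimum $k$ such that $\mathrm{cdd}(M\setminus e)\le k-1$ or $\mathrm{cdd}(M/e)\le k-1$ for some $e$. -}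

module Defs where

open import Data.Nat using (ℕ; zero; suc; _+_; _∸_; _≤_; _<_; _≥_)
open import Data.Bool using (Bool; T)
open import Data.Fin using (Fin)
open import Data.Fin.Subset
  using (Subset; _∈_; _∉_; _⊆_; ∁; _∩_; _∪_; _─_; _-_; ⁅_⁆; ∣_∣; Nonempty; Empty)
open import Data.Vec using (tabulate)
open import Data.List using (List; []; _∷_; _++_; [_]; length)
open import Data.List.Relation.Unary.Linked using (Linked)
open import Data.List.Relation.Unary.Unique.Propositional using (Unique)
open import Data.Product using (Σ; ∃; _×_; _,_)
open import Data.Sum using (_⊎_)
open import Data.Empty using (⊥)
open import Relation.Nullary using (¬_)
open import Relation.Binary.PropositionalEquality using (_≡_; _≢_)

-- Matroids, given by their rank function.
-- The ground set E is a subset of a finite universe Fin N; the rank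
-- function is only meaningful (and only ever evaluated) on subsets of E.

record RankStr (N : ℕ) : Set where
  field
    E : Subset N
    r : Subset N → ℕ

record IsMatroid {N : ℕ} (M : RankStr N) : Set where
  open RankStr M
  field
    r-bound : ∀ X → X ⊆ E → r X ≤ ∣ X ∣
    r-mono  : ∀ X Y → Y ⊆ E → X ⊆ Y → r X ≤ r Y
    r-submod : ∀ X Y → X ⊆ E → Y ⊆ E → r (X ∪ Y) + r (X ∩ Y) ≤ r X + r Y

record Matroid (N : ℕ) : Set where
  field
    str : RankStr N
    isMatroid : IsMatroid str

module _ {N : ℕ} (M : RankStr N) where
  open RankStr M

  conn : Subset N → ℕ
  conn X = r X + r (E ─ X) ∸ r E

  Separator : Subset N → Set
  Separator X = X ⊆ E × conn X ≡ 0

  Connected : Set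
  Connected = ∀ X → X ⊆ E → Nonempty X → Nonempty (E ─ X) → ¬ (conn X ≡ 0)

  IsComponent : Subset N → Set
  IsComponent C = Separator C × Nonempty C ×
    (∀ D → D ⊆ C → Nonempty D → Nonempty (C ─ D) → ¬ Separator D)

  restrict : Subset N → RankStr N
  restrict C = record { E = C ; r = r }

  delete : Fin N → RankStr N
  delete e = record { E = E - e ; r = r }

  contract : Fin N → RankStr N
  contract e = record { E = E - e ; r = λ X → r (X ∪ ⁅ e ⁆) ∸ r ⁅ e ⁆ }

-- Depth parameters.  `CD k M` means cd(M) ≤ k (similarly DD, CDD).
-- These are the recursive definitions of the paper, read as
-- "the depth is at most k" (the minimum in the paper is the least such k).

data CD {N : ℕ} : ℕ → RankStr N → Set where
  cd-empty : ∀ {k M} → Empty (RankStr.E M) → CD k M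
  cd-disconn : ∀ {k M} → ¬ Connected M →
    (∀ C → IsComponent M C → CD k (restrict M C)) → CD k M
  cd-conn : ∀ {k M} → Nonempty (RankStr.E M) → Connected M →
    (e : Fin N) → e ∈ RankStr.E M → CD k (contract M e) → CD (suc k) M

data DD {N : ℕ} : ℕ → RankStr N → Set where
  dd-empty : ∀ {k M} → Empty (RankStr.E M) → DD k M
  dd-disconn : ∀ {k M} → ¬ Connected M →
    (∀ C → IsComponent M C → DD k (restrict M C)) → DD k M
  dd-conn : ∀ {k M} → Nonempty (RankStr.E M) → Connected M →
    (e : Fin N) → e ∈ RankStr.E M → DD k (delete M e) → DD (suc k) M

data CDD {N : ℕ} : ℕ → RankStr N → Set where
  cdd-empty : ∀ {k M} → Empty (RankStr.E M) → CDD k M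
  cdd-disconn : ∀ {k M} → ¬ Connected M →
    (∀ C → IsComponent M C → CDD k (restrict M C)) → CDD k M
  cdd-conn : ∀ {k M} → Nonempty (RankStr.E M) → Connected M →
    (e : Fin N) → e ∈ RankStr.E M →
    (CDD k (delete M e) ⊎ CDD k (contract M e)) → CDD (suc k) M

record Graph (m : ℕ) : Set where
  field
    adj : Fin m → Fin m → Bool
    adj-sym : ∀ u v → T (adj u v) → T (adj v u)
    adj-irrefl : ∀ u → ¬ T (adj u u)

module _ {m : ℕ} (G : Graph m) where
  open Graph G

  Adj : Fin m → Fin m → Set
  Adj u v = T (adj u v)

  degree : Fin m → ℕ
  degree u = ∣ tabulate (adj u) ∣

  Leaf : Fin m → Set
  Leaf u = degree u ≡ 1

  Internal : Fin m → Set
  Internal u = ¬ Leaf u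

  data WalkIn (P : Fin m → Set) : Fin m → Fin m → ℕ → Set where
    here : ∀ {u} → P u → WalkIn P u u 0
    step : ∀ {u w v ℓ} → P u → Adj u w → WalkIn P w v ℓ → WalkIn P u v (suc ℓ)

  AnyVertex : Fin m → Set
  AnyVertex _ = Fin m

  GConnected : Set
  GConnected = ∀ u v → ∃ λ ℓ → WalkIn AnyVertex u v ℓ

  Cycle : List (Fin m) → Set
  Cycle [] = ⊥
  Cycle (x ∷ xs) = 3 ≤ length (x ∷ xs) × Unique (x ∷ xs) × Linked Adj (x ∷ xs ++ [ x ])

  Acyclic : Set
  Acyclic = ∀ xs → ¬ Cycle xs

  IsTree : Set
  IsTree = GConnected × Acyclic

  SameComp : Fin m → Fin m → Fin m → Set
  SameComp v u w = ∃ λ ℓ → WalkIn (λ x → x ≢ v) u w ℓ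

  RadiusAtMost : ℕ → Set
  RadiusAtMost k = ∃ λ c → ∀ u → ∃ λ ℓ → ℓ ≤ k × WalkIn AnyVertex c u ℓ

record Decomposition {N : ℕ} (M : RankStr N) : Set where
  open RankStr M
  field
    m : ℕ
    tree : Graph m
    isTree : IsTree tree
    hasInternal : ∃ λ v → Internal tree v
    σ : Fin N → Fin m
    σ-leaf : ∀ x → x ∈ E → Leaf tree (σ x)
    σ-inj : ∀ x y → x ∈ E → y ∈ E → σ x ≡ σ y → x ≡ y
    σ-onto : ∀ u → Leaf tree u → ∃ λ x → x ∈ E × σ x ≡ u

module _ {N : ℕ} {M : RankStr N} (D : Decomposition M) where
  open RankStr M
  open Decomposition D

  -- X ⊆ E is a union of parts of the partition 𝒫_v
  UnionOfParts : Fin m → Subset N → Set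
  UnionOfParts v X = X ⊆ E ×
    (∀ x y → x ∈ E → y ∈ E → SameComp tree v (σ x) (σ y) → x ∈ X → y ∈ X)

  NodeWidthAtMost : ℕ → Fin m → Set
  NodeWidthAtMost k v = ∀ X → UnionOfParts v X → conn M X ≤ k

  WidthAtMost : ℕ → Set
  WidthAtMost k = ∀ v → Internal tree v → NodeWidthAtMost k v

BD : {N : ℕ} → ℕ → RankStr N → Set
BD k M = ∣ RankStr.E M ∣ < 2 ⊎
  Σ (Decomposition M) λ D →
    WidthAtMost D k × RadiusAtMost (Decomposition.tree D) k

module Submission where

-- By induction on the cdd-derivation, every separator S of a matroid of cdd ≤ j gets a rooted
-- decomposition of height ≤ j whose root has width 0 and whose other internal vertices have
-- width ≤ j - 1.  A disconnected matroid glues the trees of its components at the root, which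
-- costs nothing because connectivity is additive across a separator.  A connected one, for which
-- M' = M \ e or M / e has cdd ≤ j - 1, hangs a leaf for e from the root of the tree of M' and puts
-- a new root above it; as λ_M(X) ≤ λ_M'(X - e) + 1, widths grow by at most one.  At the top level
-- the new root is omitted, so that the root is an internal vertex of the tree and the height bounds
-- the radius.  That cdd ≤ cd and cdd ≤ dd is immediate, each being a restricted form of the cdd step.

open import Defs
open import Data.Bool using (Bool; false; T; _∨_)
open import Data.Bool.Properties using (∨-comm; T-∨; T-≡)
open import Data.Empty using (⊥-elim) renaming (⊥ to Void)
open import Data.Fin using (Fin; zero; suc; _↑ˡ_; _↑ʳ_; splitAt)
open import Data.Fin.Properties
  using (suc-injective; any?; splitAt-↑ˡ; splitAt-↑ʳ; splitAt⁻¹-↑ˡ; splitAt⁻¹-↑ʳ)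
  renaming (_≟_ to _≟ᶠ_)
open import Data.Fin.Subset hiding (outside)
open import Data.Fin.Subset.Properties
open import Data.Nat using (ℕ; zero; suc; pred; _+_; _∸_; _≤_; _<_; z≤n; s≤s; s≤s⁻¹)
open import Data.Nat.Induction using (<-wellFounded)
open import Data.Nat.Properties hiding (suc-injective)
open import Algebra.Properties.CommutativeSemigroup +-commutativeSemigroup
  using (interchange; xy∙z≈xz∙y; xy∙z≈zy∙x)
open import Data.Product using (Σ; ∃; ∃₂; _×_; _,_; proj₁; proj₂)
open import Data.Sum using (_⊎_; inj₁; inj₂; [_,_]′)
open import Data.List using (List; []; _∷_; _++_; [_]; length)
open import Data.List.Relation.Unary.All using (All; _∷_)
open import Data.List.Relation.Unary.AllPairs using (_∷_)
open import Data.List.Relation.Unary.Linked using (Linked; [-]; _∷_)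
open import Data.List.Relation.Unary.Unique.Propositional using (Unique)
open import Data.Vec using (_∷_; here; there; tabulate)
open import Data.Vec.Properties using (lookup∘tabulate; []=⇒lookup; lookup⇒[]=)
open import Function.Base using (_∘_)
open import Function.Bundles using (Equivalence)
open import Induction.WellFounded using (Acc; acc)
open import Relation.Binary.PropositionalEquality hiding ([_])
open import Relation.Nullary using (¬_; yes; no)
open import Relation.Nullary.Decidable using (_×-dec_; ⌊_⌋; toWitness; fromWitness)

private
  variable
    n : ℕ
    x : Fin n
    p q o : Subset n

x∈p─q⇒x∉q : ∀ (p q : Subset n) → x ∈ p ─ q → x ∉ q
x∈p─q⇒x∉q (inside ∷ p)  (inside ∷ q) () here
x∈p─q⇒x∉q (false ∷ p)   (inside ∷ q) () here
x∈p─q⇒x∉q (_ ∷ p) (_ ∷ q) (there x∈p─q) (there x∈q) = x∈p─q⇒x∉q p q x∈p─q x∈q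

x∈p─q⇒x∈p : x ∈ p ─ q → x ∈ p
x∈p─q⇒x∈p {p = p} {q} = p─q⊆p p q

∪-least : p ⊆ o → q ⊆ o → p ∪ q ⊆ o
∪-least {p = p} {q = q} p⊆o q⊆o x∈p∪q with x∈p∪q⁻ p q x∈p∪q
... | inj₁ x∈p = p⊆o x∈p
... | inj₂ x∈q = q⊆o x∈q

∩-greatest : o ⊆ p → o ⊆ q → o ⊆ p ∩ q
∩-greatest o⊆p o⊆q x∈o = x∈p∩q⁺ (o⊆p x∈o , o⊆q x∈o)

─-mono : p ⊆ q → p ─ o ⊆ q ─ o
─-mono {o = o} p⊆q x∈p─o = x∈p∧x∉q⇒x∈p─q (p⊆q (x∈p─q⇒x∈p x∈p─o)) (x∈p─q⇒x∉q _ o x∈p─o)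

p⊆q∪p─q : ∀ (p q : Subset n) → p ⊆ q ∪ (p ─ q)
p⊆q∪p─q p q {x} x∈p with x ∈? q
... | yes x∈q = x∈p∪q⁺ (inj₁ x∈q)
... | no x∉q  = x∈p∪q⁺ (inj₂ (x∈p∧x∉q⇒x∈p─q x∈p x∉q))

p─[p─q]≡q : q ⊆ p → p ─ (p ─ q) ≡ q
p─[p─q]≡q {q = q} {p = p} q⊆p =
  ⊆-antisym ⊆q (λ x∈q → x∈p∧x∉q⇒x∈p─q (q⊆p x∈q) (λ x∈p─q → x∈p─q⇒x∉q p q x∈p─q x∈q))
  where
  ⊆q : p ─ (p ─ q) ⊆ q
  ⊆q {x} x∈ with x ∈? q
  ... | yes x∈q = x∈q
  ... | no x∉q  = ⊥-elim (x∈p─q⇒x∉q p _ x∈ (x∈p∧x∉q⇒x∈p─q (x∈p─q⇒x∈p x∈) x∉q))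

x∈p-y⇒x≢y : ∀ {x y : Fin n} → x ∈ p - y → x ≢ y
x∈p-y⇒x≢y {p = p} {y = y} x∈p-y refl = x∈p─q⇒x∉q p ⁅ y ⁆ x∈p-y (x∈⁅x⁆ y)

p⊆[p∩q]∪[p─q] : ∀ (p q : Subset n) → p ⊆ (p ∩ q) ∪ (p ─ q)
p⊆[p∩q]∪[p─q] p q {x} x∈p with x ∈? q
... | yes x∈q = x∈p∪q⁺ (inj₁ (x∈p∩q⁺ (x∈p , x∈q)))
... | no x∉q  = x∈p∪q⁺ (inj₂ (x∈p∧x∉q⇒x∈p─q x∈p x∉q))

p⊆q⇒p∩q≡p : p ⊆ q → p ∩ q ≡ p
p⊆q⇒p∩q≡p {p = p} {q} p⊆q = ⊆-antisym (p∩q⊆p p q) (∩-greatest ⊆-refl p⊆q)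

Uncut : Subset n → Subset n → Set
Uncut A X = ∀ {y z} → y ∈ A → z ∈ A → y ∈ X → z ∈ X

uncut⇒⊆⊎disjoint : ∀ A X → Uncut {n} A X → A ⊆ X ⊎ (∀ {x} → x ∈ A → x ∉ X)
uncut⇒⊆⊎disjoint A X uncut with any? (λ y → (y ∈? A) ×-dec (y ∈? X))
... | yes (y , y∈A , y∈X) = inj₁ (λ z∈A → uncut y∈A z∈A y∈X)
... | no ∄y               = inj₂ (λ x∈A x∈X → ∄y (_ , x∈A , x∈X))

p─q≡∅⇒p⊆q : Empty (p ─ q) → p ⊆ q
p─q≡∅⇒p⊆q {p = p} {q} p─q≡∅ {x} x∈p with x ∈? q
... | yes x∈q = x∈q
... | no x∉q  = ⊥-elim (p─q≡∅ (x , x∈p∧x∉q⇒x∈p─q x∈p x∉q))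

p⊆p-y∪⁅y⁆ : ∀ (p : Subset n) y → p ⊆ (p - y) ∪ ⁅ y ⁆
p⊆p-y∪⁅y⁆ p y {x} x∈p with x ≟ᶠ y
... | yes refl = x∈p∪q⁺ (inj₂ (x∈⁅x⁆ y))
... | no x≢y   = x∈p∪q⁺ (inj₁ (x∈p∧x≢y⇒x∈p-y x∈p x≢y))

[p─q]-y⊆[p-y]─[q-y] : ∀ (p q : Subset n) y → (p ─ q) - y ⊆ (p - y) ─ (q - y)
[p─q]-y⊆[p-y]─[q-y] p q y x∈ =
  x∈p∧x∉q⇒x∈p─q (x∈p∧x≢y⇒x∈p-y (x∈p─q⇒x∈p (x∈p─q⇒x∈p x∈)) (x∈p-y⇒x≢y x∈))
                (λ x∈q-y → x∈p─q⇒x∉q p q (x∈p─q⇒x∈p x∈) (x∈p─q⇒x∈p x∈q-y))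

p⊆⁅y⁆⇒∣p∣<2 : ∀ {y : Fin n} → p ⊆ ⁅ y ⁆ → ∣ p ∣ < 2
p⊆⁅y⁆⇒∣p∣<2 {y = y} p⊆⁅y⁆ = s≤s (≤-trans (p⊆q⇒∣p∣≤∣q∣ p⊆⁅y⁆) (≤-reflexive (∣⁅x⁆∣≡1 y)))

Empty⇒∣p∣<2 : ∀ {n} {p : Subset n} → Empty p → ∣ p ∣ < 2
Empty⇒∣p∣<2 {n} p≡∅ = subst (λ p → ∣ p ∣ < 2) (sym (Empty-unique p≡∅)) (subst (_< 2) (sym (∣⊥∣≡0 n)) (s≤s z≤n))

a∸s+b∸s+[s+s]≡a+b : ∀ {a b s} → s ≤ a → s ≤ b → (a ∸ s) + (b ∸ s) + (s + s) ≡ a + b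
a∸s+b∸s+[s+s]≡a+b {a} {b} {s} s≤a s≤b = begin
  (a ∸ s) + (b ∸ s) + (s + s)     ≡⟨ interchange (a ∸ s) s (b ∸ s) s ⟨
  ((a ∸ s) + s) + ((b ∸ s) + s)   ≡⟨ cong₂ _+_ (m∸n+n≡m s≤a) (m∸n+n≡m s≤b) ⟩
  a + b                           ∎
  where open ≡-Reasoning

module _ {N : ℕ} (R : RankStr N) where
  open RankStr R

  conn≤ : ∀ X {b} → r X + r (E ─ X) ≤ r E + b → conn R X ≤ b
  conn≤ X = m≤n+o⇒m∸n≤o _ (r E)

  conn≥ : ∀ X → r X + r (E ─ X) ≤ r E + conn R X
  conn≥ X = m≤n+m∸n _ (r E)

  conn-compl : ∀ {X} → X ⊆ E → conn R (E ─ X) ≡ conn R X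
  conn-compl {X} X⊆E =
    cong (_∸ r E) (trans (cong (λ Z → r (E ─ X) + r Z) (p─[p─q]≡q X⊆E)) (+-comm (r (E ─ X)) (r X)))

module MatroidProperties {N : ℕ} {R : RankStr N} (isMatroid : IsMatroid R) where
  open RankStr R
  open IsMatroid isMatroid

  rank-mono : ∀ {X Y} → Y ⊆ E → X ⊆ Y → r X ≤ r Y
  rank-mono = r-mono _ _

  rank-⊥ : r ⊥ ≡ 0
  rank-⊥ = n≤0⇒n≡0 (≤-trans (r-bound ⊥ ⊥⊆) (≤-reflexive (∣⊥∣≡0 N)))

  rank-∪ : ∀ {X Y} → X ⊆ E → Y ⊆ E → r (X ∪ Y) ≤ r X + r Y
  rank-∪ {X} {Y} X⊆E Y⊆E = ≤-trans (m≤m+n _ _) (r-submod X Y X⊆E Y⊆E)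

  submod-mono : ∀ {X Y U I} → X ⊆ E → Y ⊆ E → U ⊆ X ∪ Y → I ⊆ X ∩ Y → r U + r I ≤ r X + r Y
  submod-mono {X} {Y} X⊆E Y⊆E U⊆ I⊆ =
    ≤-trans (+-mono-≤ (rank-mono (∪-least X⊆E Y⊆E) U⊆) (rank-mono (⊆-trans (p∩q⊆p X Y) X⊆E) I⊆))
            (r-submod X Y X⊆E Y⊆E)

  restrict-isMatroid : ∀ {C} → C ⊆ E → IsMatroid (restrict R C)
  restrict-isMatroid C⊆E = record
    { r-bound = λ X X⊆C → r-bound X (⊆-trans X⊆C C⊆E)
    ; r-mono = λ X Y Y⊆C → r-mono X Y (⊆-trans Y⊆C C⊆E)
    ; r-submod = λ X Y X⊆C Y⊆C → r-submod X Y (⊆-trans X⊆C C⊆E) (⊆-trans Y⊆C C⊆E) }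

  conn-∅ : ∀ X → (∀ {x} → x ∉ X) → conn R X ≤ 0
  conn-∅ X X≡∅ = conn≤ R X (begin
    r X + r (E ─ X) ≤⟨ +-monoˡ-≤ _ (rank-mono ⊥⊆ (λ x∈X → ⊥-elim (X≡∅ x∈X))) ⟩
    r ⊥ + r (E ─ X) ≡⟨ cong (_+ r (E ─ X)) rank-⊥ ⟩
    r (E ─ X)       ≤⟨ rank-mono ⊆-refl (p─q⊆p E X) ⟩
    r E             ≡⟨ +-identityʳ (r E) ⟨
    r E + 0         ∎)
    where open ≤-Reasoning

  conn-E : ∀ X → X ⊆ E → E ⊆ X → conn R X ≤ 0
  conn-E X X⊆E E⊆X = conn≤ R X (begin
    r X + r (E ─ X) ≤⟨ +-monoʳ-≤ (r X) (rank-mono ⊥⊆ E─X⊆⊥) ⟩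
    r X + r ⊥       ≡⟨ cong (r X +_) rank-⊥ ⟩
    r X + 0         ≤⟨ +-monoˡ-≤ 0 (rank-mono ⊆-refl X⊆E) ⟩
    r E + 0         ∎)
    where
    open ≤-Reasoning
    E─X⊆⊥ : E ─ X ⊆ ⊥
    E─X⊆⊥ x∈ = ⊥-elim (x∈p─q⇒x∉q E X x∈ (E⊆X (x∈p─q⇒x∈p x∈)))

  conn-uncut : ∀ X → X ⊆ E → Uncut E X → conn R X ≤ 0
  conn-uncut X X⊆E uncut with uncut⇒⊆⊎disjoint E X uncut
  ... | inj₁ E⊆X     = conn-E X X⊆E E⊆X
  ... | inj₂ disjoint = conn-∅ X (λ x∈X → disjoint (X⊆E x∈X) x∈X)

  E-separator : Separator R E
  E-separator = ⊆-refl , n≤0⇒n≡0 (conn-E E ⊆-refl ⊆-refl)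

  module _ {C} (sep : Separator R C) where
    private
      C⊆E = proj₁ sep
      E─C⊆E = p─q⊆p E C

    separator-rank : r C + r (E ─ C) ≡ r E
    separator-rank = ≤-antisym (m∸n≡0⇒m≤n (proj₂ sep))
      (≤-trans (rank-mono (∪-least C⊆E E─C⊆E) (p⊆q∪p─q E C)) (rank-∪ C⊆E E─C⊆E))

    -- both inequalities are submodularity, against E ─ C and then against C
    separator-rank-additive : ∀ {A B} → A ⊆ C → B ⊆ E ─ C → r A + r B ≤ r (A ∪ B)
    separator-rank-additive {A} {B} A⊆C B⊆E─C = +-cancelʳ-≤ (r C) _ _ (begin
      r A + r B + r C       ≡⟨ xy∙z≈zy∙x (r A) (r B) (r C) ⟩
      (r C + r B) + r A     ≤⟨ +-monoˡ-≤ (r A) C-B-additive ⟩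
      r (C ∪ B) + r A       ≤⟨ submod-mono A∪B⊆E C⊆E (∪-least (q⊆p∪q (A ∪ B) C) (⊆-trans (q⊆p∪q A B) (p⊆p∪q C)))
                                 (∩-greatest (p⊆p∪q B) A⊆C) ⟩
      r (A ∪ B) + r C       ∎)
      where
      open ≤-Reasoning
      B⊆E = ⊆-trans B⊆E─C E─C⊆E
      A∪B⊆E = ∪-least (⊆-trans A⊆C C⊆E) B⊆E
      C∪B⊆E = ∪-least C⊆E B⊆E
      C-B-additive : r C + r B ≤ r (C ∪ B)
      C-B-additive = +-cancelʳ-≤ (r (E ─ C)) _ _ (begin
        r C + r B + r (E ─ C)     ≡⟨ xy∙z≈xz∙y (r C) (r B) (r (E ─ C)) ⟩
        (r C + r (E ─ C)) + r B   ≡⟨ cong (_+ r B) separator-rank ⟩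
        r E + r B                 ≤⟨ submod-mono C∪B⊆E E─C⊆E
                                       (⊆-trans (p⊆q∪p─q E C) (∪-least (⊆-trans (p⊆p∪q B) (p⊆p∪q (E ─ C))) (q⊆p∪q (C ∪ B) (E ─ C))))
                                       (∩-greatest (q⊆p∪q C B) B⊆E─C) ⟩
        r (C ∪ B) + r (E ─ C)     ∎)

    conn-split : ∀ {X} → X ⊆ E →
      conn R X ≤ conn (restrict R C) (X ∩ C) + conn (restrict R (E ─ C)) (X ─ C)
    conn-split {X} X⊆E = conn≤ R X (begin
      r X + r (E ─ X)                         ≤⟨ +-mono-≤ rX≤ rE─X≤ ⟩
      (r X₁ + r X₂) + (r Y₁ + r Y₂)           ≡⟨ interchange (r X₁) (r X₂) (r Y₁) (r Y₂) ⟩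
      (r X₁ + r Y₁) + (r X₂ + r Y₂)           ≤⟨ +-mono-≤ (conn≥ (restrict R C) X₁) (conn≥ (restrict R (E ─ C)) X₂) ⟩
      (r C + c₁) + (r (E ─ C) + c₂)           ≡⟨ interchange (r C) c₁ (r (E ─ C)) c₂ ⟩
      (r C + r (E ─ C)) + (c₁ + c₂)           ≡⟨ cong (_+ (c₁ + c₂)) separator-rank ⟩
      r E + (c₁ + c₂)                         ∎)
      where
      open ≤-Reasoning
      X₁ = X ∩ C
      X₂ = X ─ C
      Y₁ = C ─ X₁
      Y₂ = (E ─ C) ─ X₂
      c₁ = conn (restrict R C) X₁
      c₂ = conn (restrict R (E ─ C)) X₂
      X₁⊆E = ⊆-trans (p∩q⊆p X C) X⊆E
      X₂⊆E = ⊆-trans (p─q⊆p X C) X⊆E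
      Y₁⊆E = ⊆-trans (p─q⊆p C X₁) C⊆E
      Y₂⊆E = ⊆-trans (p─q⊆p (E ─ C) X₂) E─C⊆E
      rX≤ : r X ≤ r X₁ + r X₂
      rX≤ = ≤-trans (rank-mono (∪-least X₁⊆E X₂⊆E) (p⊆[p∩q]∪[p─q] X C)) (rank-∪ X₁⊆E X₂⊆E)
      E─X⊆ : E ─ X ⊆ Y₁ ∪ Y₂
      E─X⊆ {x} x∈ with x ∈? C
      ... | yes x∈C = x∈p∪q⁺ (inj₁ (x∈p∧x∉q⇒x∈p─q x∈C (λ x∈X₁ → x∈p─q⇒x∉q E X x∈ (p∩q⊆p X C x∈X₁))))
      ... | no x∉C  = x∈p∪q⁺ (inj₂ (x∈p∧x∉q⇒x∈p─q (x∈p∧x∉q⇒x∈p─q (x∈p─q⇒x∈p x∈) x∉C)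
                                      (λ x∈X₂ → x∈p─q⇒x∉q E X x∈ (x∈p─q⇒x∈p x∈X₂))))
      rE─X≤ : r (E ─ X) ≤ r Y₁ + r Y₂
      rE─X≤ = ≤-trans (rank-mono (∪-least Y₁⊆E Y₂⊆E) E─X⊆) (rank-∪ Y₁⊆E Y₂⊆E)

    conn-restrict : ∀ {X} → X ⊆ C → conn (restrict R C) X ≤ conn R X
    conn-restrict {X} X⊆C = conn≤ (restrict R C) X (+-cancelʳ-≤ (r (E ─ C)) _ _ (begin
      r X + r (C ─ X) + r (E ─ C)     ≡⟨ +-assoc (r X) _ _ ⟩
      r X + (r (C ─ X) + r (E ─ C))   ≤⟨ +-monoʳ-≤ (r X) (≤-trans additive (rank-mono (p─q⊆p E X) ⊆E─X)) ⟩
      r X + r (E ─ X)                 ≤⟨ conn≥ R X ⟩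
      r E + conn R X                  ≡⟨ cong (_+ conn R X) separator-rank ⟨
      r C + r (E ─ C) + conn R X      ≡⟨ xy∙z≈xz∙y (r C) (r (E ─ C)) (conn R X) ⟩
      r C + conn R X + r (E ─ C)      ∎))
      where
      open ≤-Reasoning
      additive : r (C ─ X) + r (E ─ C) ≤ r ((C ─ X) ∪ (E ─ C))
      additive = separator-rank-additive (p─q⊆p C X) ⊆-refl
      ⊆E─X : (C ─ X) ∪ (E ─ C) ⊆ E ─ X
      ⊆E─X = ∪-least (─-mono C⊆E)
        (λ x∈ → x∈p∧x∉q⇒x∈p─q (x∈p─q⇒x∈p x∈) (λ x∈X → x∈p─q⇒x∉q E C x∈ (X⊆C x∈X)))

    separator-compl : Separator R (E ─ C)
    separator-compl = E─C⊆E , trans (conn-compl R C⊆E) (proj₂ sep)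

module Components {N : ℕ} {R : RankStr N} (isMatroid : IsMatroid R) where
  open RankStr R
  open MatroidProperties isMatroid

  conn-split-uncut : ∀ {C X} → Separator R C → X ⊆ E → Uncut (E ─ C) X →
    conn R X ≤ conn (restrict R C) (X ∩ C)
  conn-split-uncut {C} {X} sep X⊆E uncut = begin
    conn R X          ≤⟨ conn-split sep X⊆E ⟩
    c₁ + c₂           ≤⟨ +-monoʳ-≤ c₁ c₂≤0 ⟩
    c₁ + 0            ≡⟨ +-identityʳ c₁ ⟩
    c₁                ∎
    where
    open ≤-Reasoning
    module E─C = MatroidProperties (restrict-isMatroid (p─q⊆p E C))
    c₁ = conn (restrict R C) (X ∩ C)
    c₂ = conn (restrict R (E ─ C)) (X ─ C)
    c₂≤0 : c₂ ≤ 0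
    c₂≤0 = E─C.conn-uncut (X ─ C) (─-mono X⊆E)
      (λ y∈ z∈ y∈X─C → x∈p∧x∉q⇒x∈p─q (uncut y∈ z∈ (x∈p─q⇒x∈p y∈X─C)) (x∈p─q⇒x∉q E C z∈))

  separator-─ : ∀ {S D} → Separator R S → Separator R D → D ⊆ S → Separator R (S ─ D)
  separator-─ {S} {D} sepS sepD D⊆S = S─D⊆E , n≤0⇒n≡0 (begin
    conn R (S ─ D)                     ≤⟨ conn-split-uncut sepS S─D⊆E disjoint ⟩
    conn (restrict R S) ((S ─ D) ∩ S)  ≡⟨ cong (conn (restrict R S)) (p⊆q⇒p∩q≡p (p─q⊆p S D)) ⟩
    conn (restrict R S) (S ─ D)        ≡⟨ conn-compl (restrict R S) D⊆S ⟩
    conn (restrict R S) D              ≤⟨ conn-restrict sepS D⊆S ⟩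
    conn R D                           ≡⟨ proj₂ sepD ⟩
    0                                  ∎)
    where
    open ≤-Reasoning
    S─D⊆E = ⊆-trans (p─q⊆p S D) (proj₁ sepS)
    disjoint : Uncut (E ─ S) (S ─ D)
    disjoint y∈E─S _ y∈S─D = ⊥-elim (x∈p─q⇒x∉q E S y∈E─S (x∈p─q⇒x∈p y∈S─D))

  component-connected : ∀ {C} → IsComponent R C → Connected (restrict R C)
  component-connected {C} (sepC , _ , minimal) X X⊆C X≢∅ C─X≢∅ λX≡0 =
    minimal X X⊆C X≢∅ C─X≢∅ (X⊆E , n≤0⇒n≡0 (begin
      conn R X                    ≤⟨ conn-split-uncut sepC X⊆E disjoint ⟩
      conn (restrict R C) (X ∩ C) ≡⟨ cong (conn (restrict R C)) (p⊆q⇒p∩q≡p X⊆C) ⟩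
      conn (restrict R C) X       ≡⟨ λX≡0 ⟩
      0                           ∎))
    where
    open ≤-Reasoning
    X⊆E = ⊆-trans X⊆C (proj₁ sepC)
    disjoint : Uncut (E ─ C) X
    disjoint y∈E─C _ y∈X = ⊥-elim (x∈p─q⇒x∉q E C y∈E─C (X⊆C y∈X))

  component-full⇒connected : ∀ {C} → IsComponent R C → E ⊆ C → Connected R
  component-full⇒connected {C} (_ , _ , minimal) E⊆C X X⊆E X≢∅ (y , y∈E─X) λX≡0 =
    minimal X (⊆-trans X⊆E E⊆C) X≢∅
      (y , x∈p∧x∉q⇒x∈p─q (E⊆C (x∈p─q⇒x∈p y∈E─X)) (x∈p─q⇒x∉q E X y∈E─X)) (X⊆E , λX≡0)

  connected⇒component-full : ∀ {C} → Connected R → IsComponent R C → C ≡ E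
  connected⇒component-full {C} connected ((C⊆E , λC≡0) , C≢∅ , _) = ⊆-antisym C⊆E E⊆C
    where
    E⊆C : E ⊆ C
    E⊆C {y} y∈E with y ∈? C
    ... | yes y∈C = y∈C
    ... | no y∉C  = ⊥-elim (connected C C⊆E C≢∅ (y , x∈p∧x∉q⇒x∈p─q y∈E y∉C) λC≡0)

  component-within : ∀ {x S} → Separator R S → x ∈ S →
    Σ (Subset N) λ C → IsComponent R C × x ∈ C × C ⊆ S
  component-within {x} {S} sepS x∈S = go S sepS x∈S (<-wellFounded ∣ S ∣)
    where
    ProperSeparatorThrough : Subset N → Subset N → Set
    ProperSeparatorThrough T D = D ⊆ T × Separator R D × x ∈ D × Nonempty (T ─ D)

    go : ∀ T → Separator R T → x ∈ T → Acc _<_ ∣ T ∣ → Σ (Subset N) λ C → IsComponent R C × x ∈ C × C ⊆ T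
    go T sepT x∈T (acc rec)
      with anySubset? {P = ProperSeparatorThrough T}
             (λ D → (D ⊆? T) ×-dec ((D ⊆? E) ×-dec (conn R D ≟ 0)) ×-dec (x ∈? D) ×-dec nonempty? (T ─ D))
    ... | yes (D , D⊆T , sepD , x∈D , (y , y∈T─D)) =
      let C , compC , x∈C , C⊆D = go D sepD x∈D (rec (p⊂q⇒∣p∣<∣q∣ D⊂T))
      in C , compC , x∈C , ⊆-trans C⊆D D⊆T
      where
      D⊂T : D ⊂ T
      D⊂T = D⊆T , y , x∈p─q⇒x∈p y∈T─D , x∈p─q⇒x∉q T D y∈T─D
    ... | no ∄D = T , (sepT , (x , x∈T) , minimal) , x∈T , ⊆-refl
      where
      minimal : ∀ D → D ⊆ T → Nonempty D → Nonempty (T ─ D) → ¬ Separator R D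
      minimal D D⊆T (y , y∈D) T─D≢∅ sepD with x ∈? D
      ... | yes x∈D = ∄D (D , D⊆T , sepD , x∈D , T─D≢∅)
      ... | no x∉D  = ∄D (T ─ D , p─q⊆p T D , separator-─ sepT sepD D⊆T , x∈p∧x∉q⇒x∈p─q x∈T x∉D ,
                          y , x∈p∧x∉q⇒x∈p─q (D⊆T y∈D) (λ y∈T─D → x∈p─q⇒x∉q T D y∈T─D y∈D))

record OneElementMinor {N : ℕ} (B M : RankStr N) (e : Fin N) : Set where
  field
    e∈E : e ∈ RankStr.E B
    E≡E-e : RankStr.E M ≡ RankStr.E B - e
    isMatroid : IsMatroid M
    conn≤conn+1 : ∀ X → X ⊆ RankStr.E B → conn B X ≤ conn M (X - e) + 1

module OneElementMinors {N : ℕ} {B : RankStr N} (isMatroid : IsMatroid B) {e : Fin N} (e∈E : e ∈ RankStr.E B) where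
  open RankStr B
  open IsMatroid isMatroid
  open MatroidProperties isMatroid

  private
    E-e⊆E : E - e ⊆ E
    E-e⊆E = p─q⊆p E ⁅ e ⁆

    ⁅e⁆⊆E : ⁅ e ⁆ ⊆ E
    ⁅e⁆⊆E x∈⁅e⁆ rewrite x∈⁅y⁆⇒x≡y e x∈⁅e⁆ = e∈E

    r⁅e⁆≤1 : r ⁅ e ⁆ ≤ 1
    r⁅e⁆≤1 = ≤-trans (r-bound ⁅ e ⁆ ⁅e⁆⊆E) (≤-reflexive (∣⁅x⁆∣≡1 e))

    rank-∪e : ∀ {Z} → Z ⊆ E → r (Z ∪ ⁅ e ⁆) ≤ r Z + 1
    rank-∪e {Z} Z⊆E = ≤-trans (rank-∪ Z⊆E ⁅e⁆⊆E) (+-monoʳ-≤ (r Z) r⁅e⁆≤1)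

    rank-─e : ∀ {Z} → Z ⊆ E → r Z ≤ r (Z - e) + 1
    rank-─e {Z} Z⊆E = ≤-trans (rank-mono (∪-least Z-e⊆E ⁅e⁆⊆E) (p⊆p-y∪⁅y⁆ Z e)) (rank-∪e Z-e⊆E)
      where Z-e⊆E = ⊆-trans (p─q⊆p Z ⁅ e ⁆) Z⊆E

    rank-─e-∉ : ∀ {Z} → Z ⊆ E → e ∉ Z → r Z ≤ r (Z - e)
    rank-─e-∉ {Z} Z⊆E e∉Z = rank-mono (⊆-trans (p─q⊆p Z ⁅ e ⁆) Z⊆E)
      (λ x∈Z → x∈p∧x≢y⇒x∈p-y x∈Z (λ { refl → e∉Z x∈Z }))

    -- e lies in at most one of X and E ─ X
    rank-split-─e : ∀ {X} → X ⊆ E → r X + r (E ─ X) ≤ r (X - e) + r ((E ─ X) - e) + 1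
    rank-split-─e {X} X⊆E with e ∈? X
    ... | yes e∈X = ≤-trans
      (+-mono-≤ (rank-─e X⊆E) (rank-─e-∉ (p─q⊆p E X) (λ e∈E─X → x∈p─q⇒x∉q E X e∈E─X e∈X)))
      (≤-reflexive (xy∙z≈xz∙y (r (X - e)) 1 _))
    ... | no e∉X  = ≤-trans
      (+-mono-≤ (rank-─e-∉ X⊆E e∉X) (rank-─e (p─q⊆p E X)))
      (≤-reflexive (sym (+-assoc (r (X - e)) _ 1)))

  delete-isMatroid : IsMatroid (delete B e)
  delete-isMatroid = restrict-isMatroid E-e⊆E

  conn-delete : ∀ X → X ⊆ E → conn B X ≤ conn (delete B e) (X - e) + 1
  conn-delete X X⊆E = conn≤ B X (begin
    r X + r (E ─ X)                 ≤⟨ rank-split-─e X⊆E ⟩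
    r X' + r ((E ─ X) - e) + 1      ≤⟨ +-monoˡ-≤ 1 (+-monoʳ-≤ (r X') (rank-mono (⊆-trans (p─q⊆p (E - e) X') E-e⊆E)
                                         ([p─q]-y⊆[p-y]─[q-y] E X e))) ⟩
    r X' + r ((E - e) ─ X') + 1     ≤⟨ +-monoˡ-≤ 1 (conn≥ (delete B e) X') ⟩
    r (E - e) + c' + 1              ≤⟨ +-monoˡ-≤ 1 (+-monoˡ-≤ c' (rank-mono ⊆-refl E-e⊆E)) ⟩
    r E + c' + 1                    ≡⟨ +-assoc (r E) c' 1 ⟩
    r E + (c' + 1)                  ∎)
    where
    open ≤-Reasoning
    X' = X - e
    c' = conn (delete B e) X'

  private
    s = r ⁅ e ⁆

    -- so the contracted rank r (Z ∪ ⁅ e ⁆) ∸ s never truncates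
    s≤r[Z∪e] : ∀ {Z} → Z ⊆ E → s ≤ r (Z ∪ ⁅ e ⁆)
    s≤r[Z∪e] {Z} Z⊆E = rank-mono (∪-least Z⊆E ⁅e⁆⊆E) (q⊆p∪q Z ⁅ e ⁆)

  contract-isMatroid : IsMatroid (contract B e)
  contract-isMatroid = record
    { r-bound = λ X X⊆E-e → m≤n+o⇒m∸n≤o _ s (≤-trans (rank-∪ (⊆-trans X⊆E-e E-e⊆E) ⁅e⁆⊆E)
                  (≤-trans (≤-reflexive (+-comm (r X) s)) (+-monoʳ-≤ s (r-bound X (⊆-trans X⊆E-e E-e⊆E)))))
    ; r-mono = λ X Y Y⊆E-e X⊆Y → ∸-monoˡ-≤ s (rank-mono (∪-least (⊆-trans Y⊆E-e E-e⊆E) ⁅e⁆⊆E)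
                  (∪-least (⊆-trans X⊆Y (p⊆p∪q ⁅ e ⁆)) (q⊆p∪q Y ⁅ e ⁆)))
    ; r-submod = λ X Y X⊆E-e Y⊆E-e → submod (⊆-trans X⊆E-e E-e⊆E) (⊆-trans Y⊆E-e E-e⊆E) }
    where
    submod : ∀ {X Y} → X ⊆ E → Y ⊆ E →
      (r ((X ∪ Y) ∪ ⁅ e ⁆) ∸ s) + (r ((X ∩ Y) ∪ ⁅ e ⁆) ∸ s) ≤ (r (X ∪ ⁅ e ⁆) ∸ s) + (r (Y ∪ ⁅ e ⁆) ∸ s)
    submod {X} {Y} X⊆E Y⊆E = +-cancelʳ-≤ (s + s) _ _ (begin
      (r U ∸ s) + (r I ∸ s) + (s + s)     ≡⟨ a∸s+b∸s+[s+s]≡a+b (s≤r[Z∪e] (∪-least X⊆E Y⊆E))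
                                                                 (s≤r[Z∪e] (⊆-trans (p∩q⊆p X Y) X⊆E)) ⟩
      r U + r I                           ≤⟨ submod-mono (∪-least X⊆E ⁅e⁆⊆E) (∪-least Y⊆E ⁅e⁆⊆E) U⊆ I⊆ ⟩
      r (X ∪ ⁅ e ⁆) + r (Y ∪ ⁅ e ⁆)       ≡⟨ a∸s+b∸s+[s+s]≡a+b (s≤r[Z∪e] X⊆E) (s≤r[Z∪e] Y⊆E) ⟨
      (r (X ∪ ⁅ e ⁆) ∸ s) + (r (Y ∪ ⁅ e ⁆) ∸ s) + (s + s) ∎)
      where
      open ≤-Reasoning
      U = (X ∪ Y) ∪ ⁅ e ⁆
      I = (X ∩ Y) ∪ ⁅ e ⁆
      U⊆ : U ⊆ (X ∪ ⁅ e ⁆) ∪ (Y ∪ ⁅ e ⁆)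
      U⊆ = ∪-least (∪-least (⊆-trans (p⊆p∪q ⁅ e ⁆) (p⊆p∪q _)) (⊆-trans (p⊆p∪q ⁅ e ⁆) (q⊆p∪q _ _)))
                   (⊆-trans (q⊆p∪q X ⁅ e ⁆) (p⊆p∪q _))
      I⊆ : I ⊆ (X ∪ ⁅ e ⁆) ∩ (Y ∪ ⁅ e ⁆)
      I⊆ = ∪-least (∩-greatest (⊆-trans (p∩q⊆p X Y) (p⊆p∪q ⁅ e ⁆)) (⊆-trans (p∩q⊆q X Y) (p⊆p∪q ⁅ e ⁆)))
                   (∩-greatest (q⊆p∪q X ⁅ e ⁆) (q⊆p∪q Y ⁅ e ⁆))

  conn-contract : ∀ X → X ⊆ E → conn B X ≤ conn (contract B e) (X - e) + 1
  conn-contract X X⊆E = conn≤ B X (begin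
    r X + r (E ─ X)                        ≤⟨ +-mono-≤ (rank-mono (Z∪e⊆E X'⊆E) (p⊆p-y∪⁅y⁆ X e))
                                              (rank-mono (Z∪e⊆E Y'⊆E) E─X⊆Y'∪e) ⟩
    ρX + ρY                                ≡⟨ a∸s+b∸s+[s+s]≡a+b (s≤r[Z∪e] X'⊆E) (s≤r[Z∪e] Y'⊆E) ⟨
    (ρX ∸ s) + (ρY ∸ s) + (s + s)          ≤⟨ +-monoˡ-≤ (s + s) (conn≥ (contract B e) X') ⟩
    (ρE ∸ s) + c' + (s + s)                ≡⟨ +-assoc (ρE ∸ s + c') s s ⟨
    (ρE ∸ s) + c' + s + s                  ≡⟨ cong (_+ s) (xy∙z≈xz∙y (ρE ∸ s) c' s) ⟩
    (ρE ∸ s) + s + c' + s                  ≡⟨ cong (λ t → t + c' + s) (m∸n+n≡m (s≤r[Z∪e] E-e⊆E)) ⟩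
    ρE + c' + s                            ≤⟨ +-mono-≤ (+-monoˡ-≤ c' (rank-mono ⊆-refl (Z∪e⊆E E-e⊆E))) r⁅e⁆≤1 ⟩
    r E + c' + 1                           ≡⟨ +-assoc (r E) c' 1 ⟩
    r E + (c' + 1)                         ∎)
    where
    open ≤-Reasoning
    X' = X - e
    Y' = (E - e) ─ X'
    X'⊆E = ⊆-trans (p─q⊆p X ⁅ e ⁆) X⊆E
    Y'⊆E = ⊆-trans (p─q⊆p (E - e) X') E-e⊆E
    Z∪e⊆E : ∀ {Z} → Z ⊆ E → Z ∪ ⁅ e ⁆ ⊆ E
    Z∪e⊆E Z⊆E = ∪-least Z⊆E ⁅e⁆⊆E
    E─X⊆Y'∪e : E ─ X ⊆ Y' ∪ ⁅ e ⁆
    E─X⊆Y'∪e = ⊆-trans (p⊆p-y∪⁅y⁆ (E ─ X) e)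
                 (∪-least (⊆-trans ([p─q]-y⊆[p-y]─[q-y] E X e) (p⊆p∪q ⁅ e ⁆)) (q⊆p∪q Y' ⁅ e ⁆))
    ρX = r (X' ∪ ⁅ e ⁆)
    ρY = r (Y' ∪ ⁅ e ⁆)
    ρE = r ((E - e) ∪ ⁅ e ⁆)
    c' = conn (contract B e) X'

  deletion : OneElementMinor B (delete B e) e
  deletion = record { e∈E = e∈E ; E≡E-e = refl ; isMatroid = delete-isMatroid ; conn≤conn+1 = conn-delete }

  contraction : OneElementMinor B (contract B e) e
  contraction = record { e∈E = e∈E ; E≡E-e = refl ; isMatroid = contract-isMatroid ; conn≤conn+1 = conn-contract }

-- Vertices are Fin (suc m) with root zero; the non-root vertex suc v has parent (parent v),
-- and depth certifies that following parents reaches the root.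
record RootedTree (m : ℕ) : Set where
  field
    parent : Fin m → Fin (suc m)
    depth : Fin (suc m) → ℕ
    depth-root : depth zero ≡ 0
    depth-parent : ∀ v → depth (suc v) ≡ suc (depth (parent v))

module _ {m : ℕ} (T : RootedTree m) where
  open RootedTree T

  data Ancestor (a : Fin (suc m)) : Fin (suc m) → Set where
    self : Ancestor a a
    via-parent : ∀ {v} → Ancestor a (parent v) → Ancestor a (suc v)

  Childless : Fin (suc m) → Set
  Childless u = ∀ w → parent w ≢ u

  ancestor-of-root : ∀ {a} → Ancestor a zero → a ≡ zero
  ancestor-of-root self = refl

  root-ancestor : ∀ u → Ancestor zero u
  root-ancestor u = go u (depth u) ≤-refl
    where
    go : ∀ u d → depth u ≤ d → Ancestor zero u
    go zero    _       _ = self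
    go (suc v) zero    depth≤0 with () ← subst (_≤ 0) (depth-parent v) depth≤0
    go (suc v) (suc d) depth≤ = via-parent (go (parent v) d (s≤s⁻¹ (subst (_≤ suc d) (depth-parent v) depth≤)))

  ancestor-depth : ∀ {a u} → Ancestor a u → depth a ≤ depth u
  ancestor-depth self = ≤-refl
  ancestor-depth (via-parent {v} a≼) = ≤-trans (ancestor-depth a≼) (≤-trans (n≤1+n _) (≤-reflexive (sym (depth-parent v))))

  root-child : Fin m → ∃ λ w → parent w ≡ zero
  root-child v = go (root-ancestor (suc v))
    where
    go : ∀ {v} → Ancestor zero (suc v) → ∃ λ w → parent w ≡ zero
    go (via-parent {v} ≼p) with parent v in eq | ≼p
    ... | zero  | _  = v , eq
    ... | suc _ | ≼p = go ≼p

-- The retraction collapses every edge outside the image onto the root; this is what lets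
-- ancestry in the bigger tree be pulled back.
record Embedding {m m' : ℕ} (T : RootedTree m) (T' : RootedTree m') : Set where
  private
    module T = RootedTree T
    module T' = RootedTree T'
  field
    vertex : Fin (suc m) → Fin (suc m')
    nonroot : Fin m → Fin m'
    vertex-suc : ∀ v → vertex (suc v) ≡ suc (nonroot v)
    parent-nonroot : ∀ v → T'.parent (nonroot v) ≡ vertex (T.parent v)
    retract : Fin (suc m') → Fin (suc m)
    retract-vertex : ∀ u → retract (vertex u) ≡ u
    retract-outside : ∀ v' → (∃ λ v → v' ≡ nonroot v) ⊎ (retract (suc v') ≡ zero × retract (T'.parent v') ≡ zero)

module EmbeddingProperties {m m' : ℕ} {T : RootedTree m} {T' : RootedTree m'} (emb : Embedding T T') where
  open Embedding emb
  open RootedTree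

  vertex-injective : ∀ {u u'} → vertex u ≡ vertex u' → u ≡ u'
  vertex-injective {u} {u'} eq = trans (sym (retract-vertex u)) (trans (cong retract eq) (retract-vertex u'))

  ancestor-map : ∀ {a u} → Ancestor T a u → Ancestor T' (vertex a) (vertex u)
  ancestor-map self = self
  ancestor-map {a} (via-parent {v} a≼) = subst (Ancestor T' (vertex a)) (sym (vertex-suc v))
    (via-parent (subst (Ancestor T' (vertex a)) (sym (parent-nonroot v)) (ancestor-map a≼)))

  ancestor-retract : ∀ {a u} → Ancestor T' a u → Ancestor T (retract a) (retract u)
  ancestor-retract self = self
  ancestor-retract {a} (via-parent {v'} a≼) with retract-outside v' | ancestor-retract a≼
  ... | inj₁ (v , refl) | a≼p = subst (Ancestor T (retract a)) retract-suc
                                  (via-parent (subst (Ancestor T (retract a)) retract-parent a≼p))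
    where
    retract-parent : retract (parent T' (nonroot v)) ≡ parent T v
    retract-parent = trans (cong retract (parent-nonroot v)) (retract-vertex (parent T v))
    retract-suc : suc v ≡ retract (suc (nonroot v))
    retract-suc = trans (sym (retract-vertex (suc v))) (cong retract (vertex-suc v))
  ... | inj₂ (suc↦0 , parent↦0) | a≼p = subst (Ancestor T (retract a)) (sym suc↦0) (subst (Ancestor T (retract a)) parent↦0 a≼p)

  parent-map : ∀ {w u} → parent T w ≡ u → parent T' (nonroot w) ≡ vertex u
  parent-map {w} refl = parent-nonroot w

  parent-pullback : ∀ {w' v} → parent T' w' ≡ vertex (suc v) → ∃ λ w → w' ≡ nonroot w × parent T w ≡ suc v
  parent-pullback {w'} {v} eq with retract-outside w'
  ... | inj₁ (w , refl) = w , refl , vertex-injective (trans (sym (parent-nonroot w)) eq)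
  ... | inj₂ (_ , retract-parent≡0) with () ← trans (sym (trans (cong retract eq) (retract-vertex (suc v)))) retract-parent≡0

  childless-map : ∀ v → Childless T (suc v) → Childless T' (vertex (suc v))
  childless-map v childless w' eq = let w , _ , eq' = parent-pullback eq in childless w eq'

  childless-pullback : ∀ v → Childless T' (vertex (suc v)) → Childless T (suc v)
  childless-pullback v childless w eq = childless (nonroot w) (parent-map eq)

trivialTree : RootedTree 0
trivialTree = record { parent = λ () ; depth = λ _ → 0 ; depth-root = refl ; depth-parent = λ () }

module JoinTrees {m₁ m₂ : ℕ} (T₁ : RootedTree m₁) (T₂ : RootedTree m₂) where
  private
    module T₁ = RootedTree T₁
    module T₂ = RootedTree T₂

  inl : Fin (suc m₁) → Fin (suc (m₁ + m₂))
  inl zero    = zero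
  inl (suc i) = suc (i ↑ˡ m₂)

  inr : Fin (suc m₂) → Fin (suc (m₁ + m₂))
  inr zero    = zero
  inr (suc j) = suc (m₁ ↑ʳ j)

  private
    parent : Fin (m₁ + m₂) → Fin (suc (m₁ + m₂))
    parent v = [ (λ i → inl (T₁.parent i)) , (λ j → inr (T₂.parent j)) ]′ (splitAt m₁ v)

    depth : Fin (suc (m₁ + m₂)) → ℕ
    depth zero    = 0
    depth (suc v) = [ (λ i → T₁.depth (suc i)) , (λ j → T₂.depth (suc j)) ]′ (splitAt m₁ v)

  depth-inl : ∀ u → depth (inl u) ≡ T₁.depth u
  depth-inl zero    = sym T₁.depth-root
  depth-inl (suc i) rewrite splitAt-↑ˡ m₁ i m₂ = refl

  depth-inr : ∀ u → depth (inr u) ≡ T₂.depth u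
  depth-inr zero    = sym T₂.depth-root
  depth-inr (suc j) rewrite splitAt-↑ʳ m₁ m₂ j = refl

  private
    parent-↑ˡ : ∀ i → parent (i ↑ˡ m₂) ≡ inl (T₁.parent i)
    parent-↑ˡ i rewrite splitAt-↑ˡ m₁ i m₂ = refl

    parent-↑ʳ : ∀ j → parent (m₁ ↑ʳ j) ≡ inr (T₂.parent j)
    parent-↑ʳ j rewrite splitAt-↑ʳ m₁ m₂ j = refl

    depth-parent : ∀ v → depth (suc v) ≡ suc (depth (parent v))
    depth-parent v with splitAt m₁ v
    ... | inj₁ i = trans (T₁.depth-parent i) (cong suc (sym (depth-inl (T₁.parent i))))
    ... | inj₂ j = trans (T₂.depth-parent j) (cong suc (sym (depth-inr (T₂.parent j))))

  tree : RootedTree (m₁ + m₂)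
  tree = record { parent = parent ; depth = depth ; depth-root = refl ; depth-parent = depth-parent }

  retractˡ : Fin (suc (m₁ + m₂)) → Fin (suc m₁)
  retractˡ zero    = zero
  retractˡ (suc v) = [ suc , (λ _ → zero) ]′ (splitAt m₁ v)

  retractʳ : Fin (suc (m₁ + m₂)) → Fin (suc m₂)
  retractʳ zero    = zero
  retractʳ (suc v) = [ (λ _ → zero) , suc ]′ (splitAt m₁ v)

  retractˡ-inr : ∀ u → retractˡ (inr u) ≡ zero
  retractˡ-inr zero    = refl
  retractˡ-inr (suc j) rewrite splitAt-↑ʳ m₁ m₂ j = refl

  retractʳ-inl : ∀ u → retractʳ (inl u) ≡ zero
  retractʳ-inl zero    = refl
  retractʳ-inl (suc i) rewrite splitAt-↑ˡ m₁ i m₂ = refl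

  embˡ : Embedding T₁ tree
  embˡ = record
    { vertex = inl ; nonroot = _↑ˡ m₂ ; vertex-suc = λ _ → refl
    ; parent-nonroot = parent-↑ˡ
    ; retract = retractˡ ; retract-vertex = retract-inl ; retract-outside = image-or-collapsed }
    where
    retract-inl : ∀ u → retractˡ (inl u) ≡ u
    retract-inl zero    = refl
    retract-inl (suc i) rewrite splitAt-↑ˡ m₁ i m₂ = refl
    image-or-collapsed : ∀ v → (∃ λ i → v ≡ i ↑ˡ m₂) ⊎ (retractˡ (suc v) ≡ zero × retractˡ (parent v) ≡ zero)
    image-or-collapsed v with splitAt m₁ v in eq
    ... | inj₁ i = inj₁ (i , sym (splitAt⁻¹-↑ˡ eq))
    ... | inj₂ j = inj₂ (refl , retractˡ-inr (T₂.parent j))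

  embʳ : Embedding T₂ tree
  embʳ = record
    { vertex = inr ; nonroot = m₁ ↑ʳ_ ; vertex-suc = λ _ → refl
    ; parent-nonroot = parent-↑ʳ
    ; retract = retractʳ ; retract-vertex = retract-inr ; retract-outside = image-or-collapsed }
    where
    retract-inr : ∀ u → retractʳ (inr u) ≡ u
    retract-inr zero    = refl
    retract-inr (suc j) rewrite splitAt-↑ʳ m₁ m₂ j = refl
    image-or-collapsed : ∀ v → (∃ λ j → v ≡ m₁ ↑ʳ j) ⊎ (retractʳ (suc v) ≡ zero × retractʳ (parent v) ≡ zero)
    image-or-collapsed v with splitAt m₁ v in eq
    ... | inj₂ j = inj₁ (j , sym (splitAt⁻¹-↑ʳ eq))
    ... | inj₁ i = inj₂ (refl , retractʳ-inl (T₁.parent i))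

  nonroot-cases : ∀ v → (∃ λ i → v ≡ i ↑ˡ m₂) ⊎ (∃ λ j → v ≡ m₁ ↑ʳ j)
  nonroot-cases v with splitAt m₁ v in eq
  ... | inj₁ i = inj₁ (i , sym (splitAt⁻¹-↑ˡ eq))
  ... | inj₂ j = inj₂ (j , sym (splitAt⁻¹-↑ʳ eq))

  inl≢inr : ∀ i j → inl (suc i) ≢ inr j
  inl≢inr i j eq with () ← trans (sym (Embedding.retract-vertex embˡ (suc i))) (trans (cong retractˡ eq) (retractˡ-inr j))

  inr-not-below-inl : ∀ i u → ¬ Ancestor tree (inl (suc i)) (inr u)
  inr-not-below-inl i u i≼u with () ← ancestor-of-root T₁ (subst₂ (Ancestor T₁)
    (Embedding.retract-vertex embˡ (suc i)) (retractˡ-inr u) (EmbeddingProperties.ancestor-retract embˡ i≼u))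

  inl-not-below-inr : ∀ j u → ¬ Ancestor tree (inr (suc j)) (inl u)
  inl-not-below-inr j u j≼u with () ← ancestor-of-root T₂ (subst₂ (Ancestor T₂)
    (Embedding.retract-vertex embʳ (suc j)) (retractʳ-inl u) (EmbeddingProperties.ancestor-retract embʳ j≼u))

-- A new leaf suc zero hangs from the root; the old vertex suc w becomes suc (suc w).
module AttachLeaf {m : ℕ} (T : RootedTree m) where
  private module T = RootedTree T

  shift : Fin (suc m) → Fin (suc (suc m))
  shift zero    = zero
  shift (suc w) = suc (suc w)

  shift≢leaf : ∀ u → shift u ≢ suc zero
  shift≢leaf zero    ()
  shift≢leaf (suc u) ()

  private
    parent : Fin (suc m) → Fin (suc (suc m))
    parent zero    = zero
    parent (suc v) = shift (T.parent v)

    depth : Fin (suc (suc m)) → ℕ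
    depth zero          = 0
    depth (suc zero)    = 1
    depth (suc (suc v)) = T.depth (suc v)

    depth-shift : ∀ u → depth (shift u) ≡ T.depth u
    depth-shift zero    = sym T.depth-root
    depth-shift (suc w) = refl

    depth-parent : ∀ v → depth (suc v) ≡ suc (depth (parent v))
    depth-parent zero    = refl
    depth-parent (suc v) = trans (T.depth-parent v) (cong suc (sym (depth-shift (T.parent v))))

  tree : RootedTree (suc m)
  tree = record { parent = parent ; depth = depth ; depth-root = refl ; depth-parent = depth-parent }

  leaf-childless : Childless tree (suc zero)
  leaf-childless zero    ()
  leaf-childless (suc w) eq = shift≢leaf (T.parent w) eq

  emb : Embedding T tree
  emb = record
    { vertex = shift ; nonroot = suc ; vertex-suc = λ _ → refl ; parent-nonroot = λ _ → refl
    ; retract = retract ; retract-vertex = retract-shift ; retract-outside = image-or-collapsed }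
    where
    retract : Fin (suc (suc m)) → Fin (suc m)
    retract zero          = zero
    retract (suc zero)    = zero
    retract (suc (suc w)) = suc w
    retract-shift : ∀ u → retract (shift u) ≡ u
    retract-shift zero    = refl
    retract-shift (suc w) = refl
    image-or-collapsed : ∀ v → (∃ λ w → v ≡ suc w) ⊎ (retract (suc v) ≡ zero × retract (parent v) ≡ zero)
    image-or-collapsed zero    = inj₂ (refl , refl)
    image-or-collapsed (suc w) = inj₁ (w , refl)

-- A new root zero is placed above the old root, which becomes suc zero.
module Plant {m : ℕ} (T : RootedTree m) where
  private
    module T = RootedTree T

    parent : Fin (suc m) → Fin (suc (suc m))
    parent zero    = zero
    parent (suc v) = suc (T.parent v)

    depth : Fin (suc (suc m)) → ℕ
    depth zero    = 0
    depth (suc u) = suc (T.depth u)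

    depth-parent : ∀ v → depth (suc v) ≡ suc (depth (parent v))
    depth-parent zero    = cong suc T.depth-root
    depth-parent (suc v) = cong suc (T.depth-parent v)

  tree : RootedTree (suc m)
  tree = record { parent = parent ; depth = depth ; depth-root = refl ; depth-parent = depth-parent }

  emb : Embedding T tree
  emb = record
    { vertex = suc ; nonroot = suc ; vertex-suc = λ _ → refl ; parent-nonroot = λ _ → refl
    ; retract = retract ; retract-vertex = λ _ → refl ; retract-outside = image-or-collapsed }
    where
    retract : Fin (suc (suc m)) → Fin (suc m)
    retract zero    = zero
    retract (suc u) = u
    image-or-collapsed : ∀ v → (∃ λ w → v ≡ suc w) ⊎ (retract (suc v) ≡ zero × retract (parent v) ≡ zero)
    image-or-collapsed zero    = inj₂ (refl , refl)
    image-or-collapsed (suc w) = inj₁ (w , refl)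

module _ {m : ℕ} (T : RootedTree m) {N : ℕ} (σ : Fin N → Fin (suc m)) where
  open RootedTree T

  -- x and y label leaves in the same component of T - u
  SamePart : Fin (suc m) → Fin N → Fin N → Set
  SamePart u x y = (∃ λ w → parent w ≡ u × Ancestor T (suc w) (σ x) × Ancestor T (suc w) (σ y))
                 ⊎ (¬ Ancestor T u (σ x) × ¬ Ancestor T u (σ y))

  UnionOfPartsAt : Subset N → Fin (suc m) → Subset N → Set
  UnionOfPartsAt E u X = X ⊆ E × (∀ x y → x ∈ E → y ∈ E → SamePart u x y → x ∈ X → y ∈ X)

  PartWidthAtMost : RankStr N → ℕ → Fin (suc m) → Set
  PartWidthAtMost R k u = ∀ X → UnionOfPartsAt (RankStr.E R) u X → conn R X ≤ k

module PullbackParts {m₁ m N : ℕ} {T₁ : RootedTree m₁} {T : RootedTree m} (emb : Embedding T₁ T)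
    {σ₁ : Fin N → Fin (suc m₁)} {σ : Fin N → Fin (suc m)} {E₁ E : Subset N} (E₁⊆E : E₁ ⊆ E)
    (σ≡ : ∀ {x} → x ∈ E₁ → σ x ≡ Embedding.vertex emb (σ₁ x)) where
  open Embedding emb
  open EmbeddingProperties emb

  samePart-map : ∀ {u x y} → x ∈ E₁ → y ∈ E₁ → SamePart T₁ σ₁ u x y → SamePart T σ (vertex u) x y
  samePart-map x∈ y∈ (inj₁ (w , parent≡u , w≼x , w≼y)) = inj₁ (nonroot w , parent-map parent≡u , map x∈ w≼x , map y∈ w≼y)
    where
    map : ∀ {z} → z ∈ E₁ → Ancestor T₁ (suc w) (σ₁ z) → Ancestor T (suc (nonroot w)) (σ z)
    map z∈ w≼z = subst₂ (Ancestor T) (vertex-suc w) (sym (σ≡ z∈)) (ancestor-map w≼z)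
  samePart-map {u} x∈ y∈ (inj₂ (u⋠x , u⋠y)) = inj₂ (pull x∈ u⋠x , pull y∈ u⋠y)
    where
    pull : ∀ {z} → z ∈ E₁ → ¬ Ancestor T₁ u (σ₁ z) → ¬ Ancestor T (vertex u) (σ z)
    pull {z} z∈ u⋠z u≼z = u⋠z (subst₂ (Ancestor T₁) (retract-vertex u) (retract-vertex (σ₁ z))
      (ancestor-retract (subst (Ancestor T (vertex u)) (σ≡ z∈) u≼z)))

  unionOfParts-pullback : ∀ {u X Y} → Y ⊆ E₁ →
    (∀ {x} → x ∈ E₁ → x ∈ X → x ∈ Y) → (∀ {x} → x ∈ E₁ → x ∈ Y → x ∈ X) →
    UnionOfPartsAt T σ E (vertex u) X → UnionOfPartsAt T₁ σ₁ E₁ u Y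
  unionOfParts-pullback Y⊆E₁ X⇒Y Y⇒X (_ , closed) =
    Y⊆E₁ , λ x y x∈ y∈ same x∈Y →
      X⇒Y y∈ (closed x y (E₁⊆E x∈) (E₁⊆E y∈) (samePart-map x∈ y∈ same) (Y⇒X x∈ x∈Y))

  unionOfParts-pullback-∩ : ∀ {u X} → UnionOfPartsAt T σ E (vertex u) X → UnionOfPartsAt T₁ σ₁ E₁ u (X ∩ E₁)
  unionOfParts-pullback-∩ {X = X} =
    unionOfParts-pullback (p∩q⊆q X E₁) (λ x∈E₁ x∈X → x∈p∩q⁺ (x∈X , x∈E₁)) (λ _ → p∩q⊆p X E₁)

record RootedDecomposition {N : ℕ} (R : RankStr N) (a b h : ℕ) : Set where
  open RankStr R
  field
    m : ℕ
    tree : RootedTree m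
    σ : Fin N → Fin (suc m)
    σ-leaf : ∀ x → x ∈ E → ∃ λ v → σ x ≡ suc v × Childless tree (suc v)
    σ-inj : ∀ x y → x ∈ E → y ∈ E → σ x ≡ σ y → x ≡ y
    σ-onto : ∀ v → Childless tree (suc v) → ∃ λ x → x ∈ E × σ x ≡ suc v
    depth≤ : ∀ u → RootedTree.depth tree u ≤ h
    root-width : PartWidthAtMost tree σ R a zero
    node-width : ∀ v → ¬ Childless tree (suc v) → PartWidthAtMost tree σ R b (suc v)

  nonempty⇒root-child : Nonempty E → ∃ λ w → RootedTree.parent tree w ≡ zero
  nonempty⇒root-child (x , x∈E) = let v , _ = σ-leaf x x∈E in root-child tree v

  1≤height : Nonempty E → 1 ≤ h
  1≤height (x , x∈E) = let v , _ = σ-leaf x x∈E in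
    ≤-trans (subst (1 ≤_) (sym (RootedTree.depth-parent tree v)) (s≤s z≤n)) (depth≤ (suc v))

BranchingRoot : ∀ {m} → RootedTree m → Set
BranchingRoot {m} T = ∃₂ λ (c₁ c₂ : Fin m) → c₁ ≢ c₂ × RootedTree.parent T c₁ ≡ zero × RootedTree.parent T c₂ ≡ zero

module _ {N : ℕ} {R : RankStr N} where
  open RankStr R

  weaken : ∀ {a b h a' b' h'} → a ≤ a' → b ≤ b' → h ≤ h' →
    RootedDecomposition R a b h → RootedDecomposition R a' b' h'
  weaken a≤ b≤ h≤ D = record
    { m = m ; tree = tree ; σ = σ ; σ-leaf = σ-leaf ; σ-inj = σ-inj ; σ-onto = σ-onto
    ; depth≤ = λ u → ≤-trans (depth≤ u) h≤
    ; root-width = λ X parts → ≤-trans (root-width X parts) a≤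
    ; node-width = λ v internal X parts → ≤-trans (node-width v internal X parts) b≤ }
    where open RootedDecomposition D

  module _ (isMatroid : IsMatroid R) where
    open MatroidProperties isMatroid

    trivialDecomposition : Empty E → ∀ {b h} → RootedDecomposition R 0 b h
    trivialDecomposition E≡∅ = record
      { m = 0 ; tree = trivialTree ; σ = λ _ → zero
      ; σ-leaf = λ x x∈E → ⊥-elim (E≡∅ (x , x∈E))
      ; σ-inj = λ x _ x∈E → ⊥-elim (E≡∅ (x , x∈E))
      ; σ-onto = λ ()
      ; depth≤ = λ _ → z≤n
      ; root-width = λ X (X⊆E , _) → conn-∅ X (λ x∈X → E≡∅ (_ , X⊆E x∈X))
      ; node-width = λ () }

    singletonDecomposition : ∀ {e} → e ∈ E → E ⊆ ⁅ e ⁆ → ∀ {b} → RootedDecomposition R 0 b 1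
    singletonDecomposition {e} e∈E E⊆⁅e⁆ = record
      { m = 1 ; tree = tree ; σ = λ _ → suc zero
      ; σ-leaf = λ _ _ → zero , refl , leaf-childless
      ; σ-inj = λ x y x∈E y∈E _ → trans (x∈⁅y⁆⇒x≡y e (E⊆⁅e⁆ x∈E)) (sym (x∈⁅y⁆⇒x≡y e (E⊆⁅e⁆ y∈E)))
      ; σ-onto = λ { zero _ → e , e∈E , refl }
      ; depth≤ = λ { zero → z≤n ; (suc zero) → s≤s z≤n }
      ; root-width = λ X (X⊆E , _) → conn-uncut X X⊆E uncut
      ; node-width = λ { zero internal → ⊥-elim (internal leaf-childless) } }
      where
      open AttachLeaf trivialTree
      uncut : ∀ {X} → Uncut E X
      uncut {X} y∈E z∈E = subst (_∈ X) (trans (x∈⁅y⁆⇒x≡y e (E⊆⁅e⁆ y∈E)) (sym (x∈⁅y⁆⇒x≡y e (E⊆⁅e⁆ z∈E))))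

module JoinDecompositions {N : ℕ} {R : RankStr N} (isMatroid : IsMatroid R) {C : Subset N} (sepC : Separator R C)
    {b h : ℕ} (D₁ : RootedDecomposition (restrict R C) 0 b h)
    (D₂ : RootedDecomposition (restrict R (RankStr.E R ─ C)) 0 b h) where
  open RankStr R
  open MatroidProperties isMatroid
  open Components isMatroid
  private
    module D₁ = RootedDecomposition D₁
    module D₂ = RootedDecomposition D₂
  open JoinTrees D₁.tree D₂.tree

  private
    C⊆E = proj₁ sepC
    E─C⊆E = p─q⊆p E C

    σ : Fin N → Fin (suc (D₁.m + D₂.m))
    σ x with x ∈? C
    ... | yes _ = inl (D₁.σ x)
    ... | no _  = inr (D₂.σ x)

    σ-C : ∀ {x} → x ∈ C → σ x ≡ inl (D₁.σ x)
    σ-C {x} x∈C with x ∈? C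
    ... | yes _   = refl
    ... | no x∉C = ⊥-elim (x∉C x∈C)

    σ-E─C : ∀ {x} → x ∈ E ─ C → σ x ≡ inr (D₂.σ x)
    σ-E─C {x} x∈E─C with x ∈? C
    ... | yes x∈C = ⊥-elim (x∈p─q⇒x∉q E C x∈E─C x∈C)
    ... | no _    = refl

    module P₁ = PullbackParts embˡ C⊆E σ-C
    module P₂ = PullbackParts embʳ E─C⊆E σ-E─C
    module Embˡ = EmbeddingProperties embˡ
    module Embʳ = EmbeddingProperties embʳ

    σ-leaf : ∀ x → x ∈ E → ∃ λ v → σ x ≡ suc v × Childless tree (suc v)
    σ-leaf x x∈E with x ∈? C
    ... | yes x∈C = let v , eq , childless = D₁.σ-leaf x x∈C in v ↑ˡ D₂.m , cong inl eq , Embˡ.childless-map v childless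
    ... | no x∉C  = let v , eq , childless = D₂.σ-leaf x (x∈p∧x∉q⇒x∈p─q x∈E x∉C) in
                    D₁.m ↑ʳ v , cong inr eq , Embʳ.childless-map v childless

    inl≢inr-σ : ∀ x y → x ∈ C → inl (D₁.σ x) ≢ inr (D₂.σ y)
    inl≢inr-σ x y x∈C eq = let v , σx≡ , _ = D₁.σ-leaf x x∈C in inl≢inr v (D₂.σ y) (trans (cong inl (sym σx≡)) eq)

    σ-inj : ∀ x y → x ∈ E → y ∈ E → σ x ≡ σ y → x ≡ y
    σ-inj x y x∈E y∈E eq with x ∈? C | y ∈? C
    ... | yes x∈C | yes y∈C = D₁.σ-inj x y x∈C y∈C (Embˡ.vertex-injective eq)
    ... | no x∉C  | no y∉C  =
      D₂.σ-inj x y (x∈p∧x∉q⇒x∈p─q x∈E x∉C) (x∈p∧x∉q⇒x∈p─q y∈E y∉C) (Embʳ.vertex-injective eq)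
    ... | yes x∈C | no _    = ⊥-elim (inl≢inr-σ x y x∈C eq)
    ... | no _    | yes y∈C = ⊥-elim (inl≢inr-σ y x y∈C (sym eq))

    σ-onto : ∀ v → Childless tree (suc v) → ∃ λ x → x ∈ E × σ x ≡ suc v
    σ-onto v childless with nonroot-cases v
    ... | inj₁ (i , refl) = let x , x∈C , eq = D₁.σ-onto i (Embˡ.childless-pullback i childless) in
                            x , C⊆E x∈C , trans (σ-C x∈C) (cong inl eq)
    ... | inj₂ (j , refl) = let x , x∈E─C , eq = D₂.σ-onto j (Embʳ.childless-pullback j childless) in
                            x , E─C⊆E x∈E─C , trans (σ-E─C x∈E─C) (cong inr eq)

    depth≤ : ∀ u → RootedTree.depth tree u ≤ h
    depth≤ zero = z≤n
    depth≤ (suc v) with nonroot-cases v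
    ... | inj₁ (i , refl) = subst (_≤ h) (sym (depth-inl (suc i))) (D₁.depth≤ (suc i))
    ... | inj₂ (j , refl) = subst (_≤ h) (sym (depth-inr (suc j))) (D₂.depth≤ (suc j))

    root-width : PartWidthAtMost tree σ R 0 zero
    root-width X parts@(X⊆E , _) = ≤-trans (conn-split sepC X⊆E) (+-mono-≤
      (D₁.root-width (X ∩ C) (P₁.unionOfParts-pullback-∩ parts))
      (D₂.root-width (X ─ C) (P₂.unionOfParts-pullback (─-mono X⊆E)
        (λ x∈E─C x∈X → x∈p∧x∉q⇒x∈p─q x∈X (x∈p─q⇒x∉q E C x∈E─C)) (λ _ → x∈p─q⇒x∈p) parts)))

    node-width : ∀ v → ¬ Childless tree (suc v) → PartWidthAtMost tree σ R b (suc v)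
    node-width v internal X parts@(X⊆E , closed) with nonroot-cases v
    ... | inj₁ (i , refl) = ≤-trans (conn-split-uncut sepC X⊆E uncut)
      (D₁.node-width i (internal ∘ Embˡ.childless-map i) (X ∩ C) (P₁.unionOfParts-pullback-∩ parts))
      where
      outside : ∀ {y} → y ∈ E ─ C → ¬ Ancestor tree (inl (suc i)) (σ y)
      outside {y} y∈ = subst (λ t → ¬ Ancestor tree (inl (suc i)) t) (sym (σ-E─C y∈)) (inr-not-below-inl i (D₂.σ y))
      uncut : Uncut (E ─ C) X
      uncut y∈ z∈ = closed _ _ (E─C⊆E y∈) (E─C⊆E z∈) (inj₂ (outside y∈ , outside z∈))
    ... | inj₂ (j , refl) = ≤-trans (conn-split-uncut (separator-compl sepC) X⊆E uncut)
      (D₂.node-width j (internal ∘ Embʳ.childless-map j) (X ∩ (E ─ C)) (P₂.unionOfParts-pullback-∩ parts))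
      where
      outside : ∀ {y} → y ∈ E ─ (E ─ C) → ¬ Ancestor tree (inr (suc j)) (σ y)
      outside {y} y∈ = subst (λ t → ¬ Ancestor tree (inr (suc j)) t)
        (sym (σ-C (subst (y ∈_) (p─[p─q]≡q C⊆E) y∈))) (inl-not-below-inr j (D₁.σ y))
      uncut : Uncut (E ─ (E ─ C)) X
      uncut y∈ z∈ = closed _ _ (x∈p─q⇒x∈p y∈) (x∈p─q⇒x∈p z∈) (inj₂ (outside y∈ , outside z∈))

  decomposition : RootedDecomposition R 0 b h
  decomposition = record
    { m = D₁.m + D₂.m ; tree = tree ; σ = σ ; σ-leaf = σ-leaf ; σ-inj = σ-inj ; σ-onto = σ-onto
    ; depth≤ = depth≤ ; root-width = root-width ; node-width = node-width }

  branching : Nonempty C → Nonempty (E ─ C) → BranchingRoot tree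
  branching C≢∅ E─C≢∅ =
    let w₁ , w₁-root = D₁.nonempty⇒root-child C≢∅
        w₂ , w₂-root = D₂.nonempty⇒root-child E─C≢∅
    in w₁ ↑ˡ D₂.m , D₁.m ↑ʳ w₂ , (λ eq → inl≢inr w₁ (suc w₂) (cong suc eq))
     , Embˡ.parent-map w₁-root , Embʳ.parent-map w₂-root

module AttachLeafDecomposition {N : ℕ} {B M : RankStr N} {e : Fin N} (minor : OneElementMinor B M e)
    {b h : ℕ} (1≤h : 1 ≤ h) (D : RootedDecomposition M 0 b h) where
  open RankStr B
  open OneElementMinor minor
  private
    module D = RootedDecomposition D
  open AttachLeaf D.tree

  private
    E′ = RankStr.E M

    E′⊆E : E′ ⊆ E
    E′⊆E x∈E′ = x∈p─q⇒x∈p (subst (_ ∈_) E≡E-e x∈E′)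

    E′∌e : ∀ {x} → x ∈ E′ → x ≢ e
    E′∌e x∈E′ = x∈p-y⇒x≢y (subst (_ ∈_) E≡E-e x∈E′)

    E′∋ : ∀ {x} → x ∈ E → x ≢ e → x ∈ E′
    E′∋ x∈E x≢e = subst (_ ∈_) (sym E≡E-e) (x∈p∧x≢y⇒x∈p-y x∈E x≢e)

    σ : Fin N → Fin (suc (suc D.m))
    σ x with x ≟ᶠ e
    ... | yes _ = suc zero
    ... | no _  = shift (D.σ x)

    σ-e : σ e ≡ suc zero
    σ-e with e ≟ᶠ e
    ... | yes _   = refl
    ... | no e≢e = ⊥-elim (e≢e refl)

    σ-E′ : ∀ {x} → x ∈ E′ → σ x ≡ shift (D.σ x)
    σ-E′ {x} x∈E′ with x ≟ᶠ e
    ... | yes x≡e = ⊥-elim (E′∌e x∈E′ x≡e)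
    ... | no _    = refl

    module P = PullbackParts emb E′⊆E σ-E′
    open EmbeddingProperties emb

    σ-leaf : ∀ x → x ∈ E → ∃ λ v → σ x ≡ suc v × Childless tree (suc v)
    σ-leaf x x∈E with x ≟ᶠ e
    ... | yes _   = zero , refl , leaf-childless
    ... | no x≢e = let v , eq , childless = D.σ-leaf x (E′∋ x∈E x≢e) in suc v , cong shift eq , childless-map v childless

    σ-inj : ∀ x y → x ∈ E → y ∈ E → σ x ≡ σ y → x ≡ y
    σ-inj x y x∈E y∈E eq with x ≟ᶠ e | y ≟ᶠ e
    ... | yes x≡e | yes y≡e = trans x≡e (sym y≡e)
    ... | no x≢e  | no y≢e  = D.σ-inj x y (E′∋ x∈E x≢e) (E′∋ y∈E y≢e) (vertex-injective eq)
    ... | yes _   | no _    = ⊥-elim (shift≢leaf (D.σ y) (sym eq))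
    ... | no _    | yes _   = ⊥-elim (shift≢leaf (D.σ x) eq)

    σ-onto : ∀ v → Childless tree (suc v) → ∃ λ x → x ∈ E × σ x ≡ suc v
    σ-onto zero    _         = e , e∈E , σ-e
    σ-onto (suc w) childless = let x , x∈E′ , eq = D.σ-onto w (childless-pullback w childless) in
                               x , E′⊆E x∈E′ , trans (σ-E′ x∈E′) (cong shift eq)

    depth≤ : ∀ u → RootedTree.depth tree u ≤ h
    depth≤ zero          = z≤n
    depth≤ (suc zero)    = 1≤h
    depth≤ (suc (suc w)) = D.depth≤ (suc w)

    pullback : ∀ {u X} → UnionOfPartsAt tree σ E (shift u) X → UnionOfPartsAt D.tree D.σ E′ u (X - e)
    pullback {X = X} parts@(X⊆E , _) = P.unionOfParts-pullback
      (λ x∈X-e → E′∋ (X⊆E (x∈p─q⇒x∈p x∈X-e)) (x∈p-y⇒x≢y x∈X-e))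
      (λ x∈E′ x∈X → x∈p∧x≢y⇒x∈p-y x∈X (E′∌e x∈E′)) (λ _ → x∈p─q⇒x∈p) parts

    root-width : PartWidthAtMost tree σ B 1 zero
    root-width X parts = ≤-trans (conn≤conn+1 X (proj₁ parts)) (+-monoˡ-≤ 1 (D.root-width (X - e) (pullback parts)))

    node-width : ∀ v → ¬ Childless tree (suc v) → PartWidthAtMost tree σ B (suc b) (suc v)
    node-width zero    internal = ⊥-elim (internal leaf-childless)
    node-width (suc w) internal X parts = ≤-trans (conn≤conn+1 X (proj₁ parts)) (≤-trans
      (+-monoˡ-≤ 1 (D.node-width w (λ childless → internal (childless-map w childless)) (X - e) (pullback parts)))
      (≤-reflexive (+-comm b 1)))

  decomposition : RootedDecomposition B 1 (suc b) h
  decomposition = record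
    { m = suc D.m ; tree = tree ; σ = σ ; σ-leaf = σ-leaf ; σ-inj = σ-inj ; σ-onto = σ-onto
    ; depth≤ = depth≤ ; root-width = root-width ; node-width = node-width }

  branching : Nonempty E′ → BranchingRoot tree
  branching E′≢∅ = let w , w-root = D.nonempty⇒root-child E′≢∅ in
    zero , suc w , (λ ()) , refl , parent-map w-root

module PlantDecomposition {N : ℕ} {R : RankStr N} (isMatroid : IsMatroid R) (E≢∅ : Nonempty (RankStr.E R))
    {a b c h : ℕ} (a≤c : a ≤ c) (b≤c : b ≤ c) (D : RootedDecomposition R a b h) where
  open RankStr R
  open MatroidProperties isMatroid
  private
    module D = RootedDecomposition D
  open Plant D.tree
  private
    σ : Fin N → Fin (suc (suc D.m))
    σ x = suc (D.σ x)

    module P = PullbackParts emb {σ₁ = D.σ} {σ = σ} {E₁ = E} ⊆-refl (λ _ → refl)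
    open EmbeddingProperties emb

    pullback : ∀ {u X} → UnionOfPartsAt tree σ E (suc u) X → UnionOfPartsAt D.tree D.σ E u X
    pullback parts = P.unionOfParts-pullback (proj₁ parts) (λ _ x∈X → x∈X) (λ _ x∈X → x∈X) parts

    old-root-internal : ¬ Childless tree (suc zero)
    old-root-internal childless = let w , w-root = D.nonempty⇒root-child E≢∅ in childless (suc w) (cong suc w-root)

    σ-onto : ∀ v → Childless tree (suc v) → ∃ λ x → x ∈ E × σ x ≡ suc v
    σ-onto zero    childless = ⊥-elim (old-root-internal childless)
    σ-onto (suc w) childless = let x , x∈E , eq = D.σ-onto w (childless-pullback w childless) in x , x∈E , cong suc eq

    -- every element lies below the single child of the new root
    root-width : PartWidthAtMost tree σ R 0 zero
    root-width X (X⊆E , closed) = conn-uncut X X⊆E λ {y} {z} y∈E z∈E →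
      closed y z y∈E z∈E (inj₁ (zero , refl , below y , below z))
      where
      below : ∀ x → Ancestor tree (suc zero) (σ x)
      below x = ancestor-map (root-ancestor D.tree (D.σ x))

    node-width : ∀ v → ¬ Childless tree (suc v) → PartWidthAtMost tree σ R c (suc v)
    node-width zero    _        X parts = ≤-trans (D.root-width X (pullback parts)) a≤c
    node-width (suc w) internal X parts =
      ≤-trans (D.node-width w (λ childless → internal (childless-map w childless)) X (pullback parts)) b≤c

  decomposition : RootedDecomposition R 0 c (suc h)
  decomposition = record
    { m = suc D.m ; tree = tree ; σ = σ
    ; σ-leaf = λ x x∈E → let v , eq , childless = D.σ-leaf x x∈E in suc v , cong suc eq , childless-map v childless
    ; σ-inj = λ x y x∈E y∈E eq → D.σ-inj x y x∈E y∈E (suc-injective eq)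
    ; σ-onto = σ-onto
    ; depth≤ = λ { zero → z≤n ; (suc u) → s≤s (D.depth≤ u) }
    ; root-width = root-width ; node-width = node-width }

module _ {n : ℕ} {f : Fin n → Bool} where
  ∈-tabulate⁺ : ∀ {v} → T (f v) → v ∈ tabulate f
  ∈-tabulate⁺ {v} fv = lookup⇒[]= v (tabulate f) (trans (lookup∘tabulate f v) (Equivalence.to T-≡ fv))

  ∈-tabulate⁻ : ∀ {v} → v ∈ tabulate f → T (f v)
  ∈-tabulate⁻ {v} v∈ = Equivalence.from T-≡ (trans (sym (lookup∘tabulate f v)) ([]=⇒lookup v∈))

  ∣tabulate∣≡1 : ∀ {w} → T (f w) → (∀ v → T (f v) → v ≡ w) → ∣ tabulate f ∣ ≡ 1
  ∣tabulate∣≡1 {w} fw unique = trans (cong ∣_∣ tabulate≡⁅w⁆) (∣⁅x⁆∣≡1 w)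
    where
    tabulate≡⁅w⁆ : tabulate f ≡ ⁅ w ⁆
    tabulate≡⁅w⁆ = ⊆-antisym (λ v∈ → subst (_∈ ⁅ w ⁆) (sym (unique _ (∈-tabulate⁻ v∈))) (x∈⁅x⁆ w))
                             (λ v∈⁅w⁆ → subst (_∈ tabulate f) (sym (x∈⁅y⁆⇒x≡y w v∈⁅w⁆)) (∈-tabulate⁺ fw))

  2≤∣tabulate∣ : ∀ {w₁ w₂} → w₁ ≢ w₂ → T (f w₁) → T (f w₂) → 2 ≤ ∣ tabulate f ∣
  2≤∣tabulate∣ {w₁} {w₂} w₁≢w₂ fw₁ fw₂ = subst (_< ∣ tabulate f ∣) (∣⁅x⁆∣≡1 w₁)
    (p⊂q⇒∣p∣<∣q∣ ((λ v∈⁅w₁⁆ → subst (_∈ tabulate f) (sym (x∈⁅y⁆⇒x≡y w₁ v∈⁅w₁⁆)) (∈-tabulate⁺ fw₁)) ,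
                  w₂ , ∈-tabulate⁺ fw₂ , λ w₂∈⁅w₁⁆ → w₁≢w₂ (sym (x∈⁅y⁆⇒x≡y w₁ w₂∈⁅w₁⁆))))

module Walks {n : ℕ} (G : Graph n) where
  private
    variable
      P P′ : Fin n → Set
      u v w : Fin n
      ℓ ℓ′ : ℕ

  walk-map : (∀ z → P z → P′ z) → WalkIn G P u v ℓ → WalkIn G P′ u v ℓ
  walk-map f (here p)        = here (f _ p)
  walk-map f (step p adj ws) = step (f _ p) adj (walk-map f ws)

  walk-snoc : WalkIn G P u w ℓ → Adj G w v → P v → WalkIn G P u v (suc ℓ)
  walk-snoc (here p)        adj pv = step p adj (here pv)
  walk-snoc (step p adj ws) adj′ pv = step p adj (walk-snoc ws adj′ pv)

  walk-reverse : WalkIn G P u v ℓ → WalkIn G P v u ℓ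
  walk-reverse (here p)              = here p
  walk-reverse {u = u} (step p adj ws) = walk-snoc (walk-reverse ws) (Graph.adj-sym G u _ adj) p

  walk-++ : WalkIn G P u w ℓ → WalkIn G P w v ℓ′ → WalkIn G P u v (ℓ + ℓ′)
  walk-++ (here _)        ws′ = ws′
  walk-++ (step p adj ws) ws′ = step p adj (walk-++ ws ws′)

module TreeGraph {m : ℕ} (Tr : RootedTree m) where
  open RootedTree Tr

  ChildOf : Fin (suc m) → Fin (suc m) → Set
  ChildOf u v = ∃ λ a → u ≡ suc a × parent a ≡ v

  private
    isChildOf : Fin (suc m) → Fin (suc m) → Bool
    isChildOf zero    _ = false
    isChildOf (suc a) v = ⌊ parent a ≟ᶠ v ⌋

    childOf⁻ : ∀ {u v} → T (isChildOf u v) → ChildOf u v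
    childOf⁻ {suc a} t = a , refl , toWitness t

    childOf⁺ : ∀ {u v} → ChildOf u v → T (isChildOf u v)
    childOf⁺ (a , refl , eq) = fromWitness eq

  depth-child : ∀ {u v} → ChildOf u v → depth u ≡ suc (depth v)
  depth-child (a , refl , refl) = depth-parent a

  parent-unique : ∀ {u v w} → ChildOf u v → ChildOf u w → v ≡ w
  parent-unique (a , refl , eq₁) (.a , refl , eq₂) = trans (sym eq₁) eq₂

  graph : Graph (suc m)
  graph = record
    { adj = λ u v → isChildOf u v ∨ isChildOf v u
    ; adj-sym = λ u v → subst T (∨-comm (isChildOf u v) (isChildOf v u))
    ; adj-irrefl = λ u adj → [ loop u , loop u ]′ (Equivalence.to (T-∨ {isChildOf u u} {isChildOf u u}) adj) }
    where
    loop : ∀ u → ¬ T (isChildOf u u)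
    loop u t = 1+n≢n (sym (depth-child (childOf⁻ {u} {u} t)))

  adjacent⁻ : ∀ {u v} → Adj graph u v → ChildOf u v ⊎ ChildOf v u
  adjacent⁻ adj = Data.Sum.map childOf⁻ childOf⁻ (Equivalence.to T-∨ adj)

  adjacent-up : ∀ {u v} → ChildOf u v → Adj graph u v
  adjacent-up c = Equivalence.from T-∨ (inj₁ (childOf⁺ c))

  adjacent-down : ∀ {u v} → ChildOf v u → Adj graph u v
  adjacent-down c = Equivalence.from T-∨ (inj₂ (childOf⁺ c))

  private
    endpoint : Fin (suc m) → List (Fin (suc m)) → Fin (suc m)
    endpoint a []      = a
    endpoint a (b ∷ l) = endpoint b l

    next : Fin (suc m) → List (Fin (suc m)) → Fin (suc m)
    next z []      = z
    next z (d ∷ _) = d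

    linked-init : ∀ a l z → Linked (Adj graph) (a ∷ l ++ [ z ]) → Linked (Adj graph) (a ∷ l)
    linked-init a []      z _              = [-]
    linked-init a (b ∷ l) z (adj ∷ linked) = adj ∷ linked-init b l z linked

    linked-last : ∀ a l z → Linked (Adj graph) (a ∷ l ++ [ z ]) → Adj graph (endpoint a l) z
    linked-last a []      z (adj ∷ _)    = adj
    linked-last a (b ∷ l) z (_ ∷ linked) = linked-last b l z linked

    all-endpoint : ∀ {P : Fin (suc m) → Set} a l → All P (a ∷ l) → P (endpoint a l)
    all-endpoint a []      (pa ∷ _)  = pa
    all-endpoint a (b ∷ l) (_ ∷ ps) = all-endpoint b l ps

    -- a path without repeated vertices that steps down once keeps stepping down
    descending : ∀ a b l → Unique (a ∷ b ∷ l) → Linked (Adj graph) (a ∷ b ∷ l) → ChildOf b a →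
                 depth (endpoint b l) ≡ depth a + suc (length l)
    descending a b []      _ _ b↓a = trans (depth-child b↓a) (+-comm 1 (depth a))
    descending a b (c ∷ l) ((_ ∷ a≢c ∷ _) ∷ unique) (_ ∷ adj ∷ linked) b↓a with adjacent⁻ adj
    ... | inj₁ b↓c = ⊥-elim (a≢c (parent-unique b↓a b↓c))
    ... | inj₂ c↓b = trans (descending b c l unique (adj ∷ linked) c↓b)
      (trans (cong (_+ suc (length l)) (depth-child b↓a)) (sym (+-suc (depth a) (suc (length l)))))

    -- and, read backwards, a path that ends by stepping up has been stepping up throughout
    ascending : ∀ b l z → Unique (b ∷ l) → All (z ≢_) (b ∷ l) → Linked (Adj graph) (b ∷ l ++ [ z ]) →
                ChildOf (endpoint b l) z → ChildOf b (next z l) × depth z < depth b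
    ascending b []      z _ _ (adj ∷ [-]) b↑z = b↑z , ≤-reflexive (sym (depth-child b↑z))
    ascending b (c ∷ l) z (b∉ ∷ unique) (z≢b ∷ z∉) (adj ∷ linked) end↑z
      with ascending c l z unique z∉ linked end↑z | adjacent⁻ adj
    ... | _ , z<c     | inj₁ b↑c = b↑c , <-trans z<c (≤-reflexive (sym (depth-child b↑c)))
    ... | c↑next , _  | inj₂ c↑b = ⊥-elim (b≢next l b∉ z≢b (parent-unique c↑b c↑next))
      where
      b≢next : ∀ l → All (b ≢_) (c ∷ l) → z ≢ b → b ≢ next z l
      b≢next []      _                _   b≡z = z≢b (sym b≡z)
      b≢next (_ ∷ _) (_ ∷ b≢d ∷ _) _   b≡d = b≢d b≡d

  acyclic : Acyclic graph
  acyclic []                  ()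
  acyclic (_ ∷ [])            (s≤s () , _)
  acyclic (_ ∷ _ ∷ [])        (s≤s (s≤s ()) , _)
  acyclic (x ∷ x₁ ∷ x₂ ∷ ys) (_ , unique@(x∉ ∷ unique′) , linked@(adj ∷ linked′))
    with adjacent⁻ adj | adjacent⁻ (linked-last x (x₁ ∷ x₂ ∷ ys) x linked)
  ... | inj₂ x₁↓x | last-edge = contradiction (Data.Sum.map depth-child depth-child last-edge)
    where
    k = length ys
    d≡ : depth (endpoint x₂ ys) ≡ depth x + suc (suc k)
    d≡ = descending x x₁ (x₂ ∷ ys) unique (linked-init x (x₁ ∷ x₂ ∷ ys) x linked) x₁↓x
    contradiction : depth (endpoint x₂ ys) ≡ suc (depth x) ⊎ depth x ≡ suc (depth (endpoint x₂ ys)) → Void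
    contradiction (inj₁ eq) = m+1+n≢m (depth x) (cong pred (trans (sym (+-suc (depth x) (suc k))) (trans (sym d≡) eq)))
    contradiction (inj₂ eq) = m≢1+m+n (depth x) (trans eq (cong suc d≡))
  ... | inj₁ x↑x₁ | inj₁ end↑x = <-asym (proj₂ (ascending x₁ (x₂ ∷ ys) x unique′ x∉ linked′ end↑x))
                                        (≤-reflexive (sym (depth-child x↑x₁)))
  ... | inj₁ x↑x₁ | inj₂ x↑end = all-endpoint {P = x₁ ≢_} x₂ ys (head-distinct unique′) (parent-unique x↑x₁ x↑end)
    where
    head-distinct : ∀ {a l} → Unique (a ∷ l) → All (a ≢_) l
    head-distinct (a∉ ∷ _) = a∉

  open Walks graph

  walk-up : ∀ {a u} → Ancestor Tr a u →
    ∃ λ ℓ → ℓ + depth a ≡ depth u × WalkIn graph (λ z → Ancestor Tr a z × Ancestor Tr z u) u a ℓ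
  walk-up self = 0 , refl , here (self , self)
  walk-up (via-parent {v} a≼) =
    let ℓ , ℓ+depth≡ , ws = walk-up a≼ in
    suc ℓ , trans (cong suc ℓ+depth≡) (sym (depth-parent v)) ,
    step (via-parent a≼ , self) (adjacent-up (v , refl , refl)) (walk-map (λ _ (a≼z , z≼) → a≼z , via-parent z≼) ws)

  connected : GConnected graph
  connected u v =
    let ℓ , _ , wu = walk-up (root-ancestor Tr u)
        ℓ′ , _ , wv = walk-up (root-ancestor Tr v)
    in ℓ + ℓ′ , walk-++ (walk-map (λ z _ → z) wu) (walk-reverse (walk-map (λ z _ → z) wv))

  radius≤ : ∀ {k} → (∀ u → depth u ≤ k) → RadiusAtMost graph k
  radius≤ depth≤ = zero , λ u →
    let ℓ , ℓ+0≡ , ws = walk-up (root-ancestor Tr u) in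
    ℓ , ≤-trans (≤-trans (m≤m+n ℓ _) (≤-reflexive ℓ+0≡)) (depth≤ u) , walk-reverse (walk-map (λ z _ → z) ws)

  samePart⇒sameComp : ∀ {N} (σ : Fin N → Fin (suc m)) {u x y} → SamePart Tr σ u x y → SameComp graph u (σ x) (σ y)
  samePart⇒sameComp σ {u} {x} {y} (inj₁ (w , w↑u , w≼x , w≼y)) =
    let ℓ , _ , wx = walk-up w≼x
        ℓ′ , _ , wy = walk-up w≼y
    in ℓ + ℓ′ , walk-++ (walk-map avoids wx) (walk-reverse (walk-map avoids wy))
    where
    avoids : ∀ {t} z → Ancestor Tr (suc w) z × Ancestor Tr z t → z ≢ u
    avoids z (w≼z , _) refl = 1+n≰n (≤-trans (≤-reflexive (sym (trans (depth-parent w) (cong (suc ∘ depth) w↑u))))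
                                               (ancestor-depth Tr w≼z))
  samePart⇒sameComp σ {u} {x} {y} (inj₂ (u⋠x , u⋠y)) =
    let ℓ , _ , wx = walk-up (root-ancestor Tr (σ x))
        ℓ′ , _ , wy = walk-up (root-ancestor Tr (σ y))
    in ℓ + ℓ′ , walk-++ (walk-map (avoids u⋠x) wx) (walk-reverse (walk-map (avoids u⋠y) wy))
    where
    avoids : ∀ {t} → ¬ Ancestor Tr u t → ∀ z → Ancestor Tr zero z × Ancestor Tr z t → z ≢ u
    avoids u⋠t z (_ , z≼t) refl = u⋠t z≼t

  childless⇒leaf : ∀ a → Childless Tr (suc a) → Leaf graph (suc a)
  childless⇒leaf a childless = ∣tabulate∣≡1 {f = Graph.adj graph (suc a)} (adjacent-up (a , refl , refl)) only-parent
    where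
    only-parent : ∀ v → Adj graph (suc a) v → v ≡ parent a
    only-parent v adj with adjacent⁻ {suc a} {v} adj
    ... | inj₁ (a′ , eq , parent≡v) = trans (sym parent≡v) (cong parent (sym (suc-injective eq)))
    ... | inj₂ (w , refl , parent≡) = ⊥-elim (childless w parent≡)

  parent-not-leaf : ∀ a w → parent w ≡ suc a → ¬ Leaf graph (suc a)
  parent-not-leaf a w w↑a leaf = 1+n≰n (≤-trans
    (2≤∣tabulate∣ {f = Graph.adj graph (suc a)} parent≢child (adjacent-up (a , refl , refl)) (adjacent-down (w , refl , w↑a)))
    (≤-reflexive leaf))
    where
    parent≢child : parent a ≢ suc w
    parent≢child eq = m≢1+m+n (depth (parent a)) {1} (begin
      depth (parent a)     ≡⟨ cong depth eq ⟩
      depth (suc w)        ≡⟨ depth-parent w ⟩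
      suc (depth (parent w)) ≡⟨ cong (suc ∘ depth) w↑a ⟩
      suc (depth (suc a))  ≡⟨ cong suc (depth-parent a) ⟩
      suc (suc (depth (parent a))) ≡⟨ cong suc (+-comm 1 _) ⟩
      suc (depth (parent a) + 1) ∎)
      where open ≡-Reasoning

  module _ (branching : BranchingRoot Tr) where
    root-internal : Internal graph zero
    root-internal leaf =
      let c₁ , c₂ , c₁≢c₂ , c₁↑ , c₂↑ = branching in
      1+n≰n (≤-trans (2≤∣tabulate∣ {f = Graph.adj graph zero} (c₁≢c₂ ∘ suc-injective)
                                   (adjacent-down (c₁ , refl , c₁↑)) (adjacent-down (c₂ , refl , c₂↑)))
                     (≤-reflexive leaf))

    leaf⇒childless : ∀ u → Leaf graph u → ∃ λ a → u ≡ suc a × Childless Tr (suc a)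
    leaf⇒childless zero    leaf = ⊥-elim (root-internal leaf)
    leaf⇒childless (suc a) leaf with any? (λ w → parent w ≟ᶠ suc a)
    ... | yes (w , w↑a) = ⊥-elim (parent-not-leaf a w w↑a leaf)
    ... | no ∄w         = a , refl , λ w w↑a → ∄w (w , w↑a)

module _ {N : ℕ} {R : RankStr N} {k : ℕ} (D : RootedDecomposition R k k k) where
  open RankStr R
  private
    module D = RootedDecomposition D
  open TreeGraph D.tree

  toDecomposition : BranchingRoot D.tree →
    Σ (Decomposition R) λ 𝒟 → WidthAtMost 𝒟 k × RadiusAtMost (Decomposition.tree 𝒟) k
  toDecomposition branching = 𝒟 , width , radius≤ D.depth≤
    where
    𝒟 : Decomposition R
    𝒟 = record
      { m = suc D.m ; tree = graph ; isTree = connected , acyclic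
      ; hasInternal = zero , root-internal branching
      ; σ = D.σ
      ; σ-leaf = λ x x∈E → let v , eq , childless = D.σ-leaf x x∈E in
                           subst (Leaf graph) (sym eq) (childless⇒leaf v childless)
      ; σ-inj = D.σ-inj
      ; σ-onto = λ u leaf → let a , u≡ , childless = leaf⇒childless branching u leaf
                                x , x∈E , eq = D.σ-onto a childless
                            in x , x∈E , trans eq (sym u≡) }

    parts : ∀ {u X} → UnionOfParts 𝒟 u X → UnionOfPartsAt D.tree D.σ E u X
    parts (X⊆E , closed) = X⊆E , λ x y x∈E y∈E same → closed x y x∈E y∈E (samePart⇒sameComp D.σ same)

    width : WidthAtMost 𝒟 k
    width zero    _        X X-parts = D.root-width X (parts X-parts)
    width (suc a) internal X X-parts = D.node-width a (internal ∘ childless⇒leaf a) X (parts X-parts)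

module _ {N : ℕ} where
  minorOf : ∀ {k} {B : RankStr N} → IsMatroid B → ∀ {e} → e ∈ RankStr.E B →
    CDD k (delete B e) ⊎ CDD k (contract B e) → Σ (RankStr N) λ M → OneElementMinor B M e × CDD k M
  minorOf {B = B} isMatroid {e} e∈E (inj₁ d) = delete B e , OneElementMinors.deletion isMatroid e∈E , d
  minorOf {B = B} isMatroid {e} e∈E (inj₂ d) = contract B e , OneElementMinors.contraction isMatroid e∈E , d

  minor-empty⇒singleton : ∀ {B M : RankStr N} {e} → OneElementMinor B M e → Empty (RankStr.E M) → RankStr.E B ⊆ ⁅ e ⁆
  minor-empty⇒singleton minor E′≡∅ = p─q≡∅⇒p⊆q (subst Empty (OneElementMinor.E≡E-e minor) E′≡∅)

  cone : ∀ {B M : RankStr N} {e k} → IsMatroid B → OneElementMinor B M e →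
    RootedDecomposition M 0 (k ∸ 1) k → RootedDecomposition B 0 k (suc k)
  cone {M = M} {e} {k} isMatroid minor D with nonempty? (RankStr.E M)
  ... | yes E′≢∅ = PlantDecomposition.decomposition isMatroid (e , e∈E) 1≤k 1+[k∸1]≤k
                     (AttachLeafDecomposition.decomposition minor 1≤k D)
    where
    open OneElementMinor minor using (e∈E)
    1≤k = RootedDecomposition.1≤height D E′≢∅
    1+[k∸1]≤k = ≤-reflexive (trans (+-comm 1 (k ∸ 1)) (m∸n+n≡m 1≤k))
  ... | no E′≡∅ = weaken ≤-refl ≤-refl (s≤s z≤n)
                    (singletonDecomposition isMatroid (OneElementMinor.e∈E minor) (minor-empty⇒singleton minor E′≡∅))

  mutual
    separatorDecomposition : ∀ {j} {A : RankStr N} → IsMatroid A → CDD j A →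
      ∀ S → Separator A S → Acc _<_ ∣ S ∣ → RootedDecomposition (restrict A S) 0 (j ∸ 1) j
    separatorDecomposition {A = A} isMatroid d S sepS (acc rec) with nonempty? S
    ... | no S≡∅ = trivialDecomposition (restrict-isMatroid (proj₁ sepS)) S≡∅
      where open MatroidProperties isMatroid
    ... | yes (x , x∈S) with Components.component-within isMatroid sepS x∈S
    ...   | C , compC , x∈C , C⊆S =
      JoinDecompositions.decomposition (restrict-isMatroid (proj₁ sepS)) sepC-in-S
        (componentDecomposition isMatroid d C compC)
        (separatorDecomposition isMatroid d (S ─ C) (separator-─ sepS (proj₁ compC) C⊆S)
           (rec (p∩q≢∅⇒∣p─q∣<∣p∣ S C (x , x∈p∩q⁺ (x∈S , x∈C)))))
      where
      open MatroidProperties isMatroid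
      open Components isMatroid
      sepC-in-S : Separator (restrict A S) C
      sepC-in-S = C⊆S , n≤0⇒n≡0 (≤-trans (conn-restrict sepS C⊆S) (≤-reflexive (proj₂ (proj₁ compC))))

    componentDecomposition : ∀ {j} {A : RankStr N} → IsMatroid A → CDD j A →
      ∀ C → IsComponent A C → RootedDecomposition (restrict A C) 0 (j ∸ 1) j
    componentDecomposition isMatroid (cdd-empty E≡∅) C ((C⊆E , _) , (x , x∈C) , _) = ⊥-elim (E≡∅ (x , C⊆E x∈C))
    componentDecomposition isMatroid (cdd-disconn _ d) C compC@((C⊆E , _) , C≢∅ , _) =
      connectedDecomposition (MatroidProperties.restrict-isMatroid isMatroid C⊆E)
        (Components.component-connected isMatroid compC) C≢∅ (d C compC)
    componentDecomposition {A = A} isMatroid d@(cdd-conn E≢∅ connected _ _ _) C compC =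
      subst (λ Z → RootedDecomposition (restrict A Z) _ _ _)
        (sym (Components.connected⇒component-full isMatroid connected compC))
        (connectedDecomposition isMatroid connected E≢∅ d)

    connectedDecomposition : ∀ {j} {B : RankStr N} → IsMatroid B → Connected B → Nonempty (RankStr.E B) →
      CDD j B → RootedDecomposition B 0 (j ∸ 1) j
    connectedDecomposition _ _ E≢∅ (cdd-empty E≡∅) = ⊥-elim (E≡∅ E≢∅)
    connectedDecomposition _ connected _ (cdd-disconn disconnected _) = ⊥-elim (disconnected connected)
    connectedDecomposition isMatroid _ _ (cdd-conn _ _ e e∈E d) =
      let M , minor , d′ = minorOf isMatroid e∈E d
          isMatroid′ = OneElementMinor.isMatroid minor
      in cone isMatroid minor (separatorDecomposition isMatroid′ d′ (RankStr.E M)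
                                 (MatroidProperties.E-separator isMatroid′) (<-wellFounded _))

  wholeDecomposition : ∀ {j} {A : RankStr N} → IsMatroid A → CDD j A → RootedDecomposition A 0 (j ∸ 1) j
  wholeDecomposition isMatroid d =
    separatorDecomposition isMatroid d _ (MatroidProperties.E-separator isMatroid) (<-wellFounded _)

  branch-depth≤cdd : ∀ {k} {A : RankStr N} → IsMatroid A → CDD k A → BD k A
  branch-depth≤cdd isMatroid (cdd-empty E≡∅) = inj₁ (Empty⇒∣p∣<2 E≡∅)
  branch-depth≤cdd isMatroid (cdd-conn {k = k} _ _ e e∈E d) with minorOf isMatroid e∈E d
  ... | M , minor , d′ with nonempty? (RankStr.E M)
  ...   | no E′≡∅ = inj₁ (p⊆⁅y⁆⇒∣p∣<2 (minor-empty⇒singleton minor E′≡∅))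
  ...   | yes E′≢∅ = inj₂ (toDecomposition (weaken (s≤s z≤n) (s≤s (m∸n≤m k 1)) (n≤1+n k) attached)
                                         (AttachLeafDecomposition.branching minor 1≤k D E′≢∅))
    where
    D = wholeDecomposition (OneElementMinor.isMatroid minor) d′
    1≤k = RootedDecomposition.1≤height D E′≢∅
    attached = AttachLeafDecomposition.decomposition minor 1≤k D
  branch-depth≤cdd {k} {A} isMatroid d@(cdd-disconn disconnected _) with nonempty? (RankStr.E A)
  ... | no E≡∅ = inj₁ (Empty⇒∣p∣<2 E≡∅)
  ... | yes (x , x∈E) with Components.component-within isMatroid (MatroidProperties.E-separator isMatroid) x∈E
  ...   | C , compC , x∈C , _ with nonempty? (RankStr.E A ─ C)
  ...     | no E─C≡∅ = ⊥-elim (disconnected (Components.component-full⇒connected isMatroid compC (p─q≡∅⇒p⊆q E─C≡∅)))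
  ...     | yes E─C≢∅ = inj₂ (toDecomposition (weaken z≤n (m∸n≤m k 1) ≤-refl J.decomposition)
                                              (J.branching (x , x∈C) E─C≢∅))
    where
    sepC = proj₁ compC
    module J = JoinDecompositions isMatroid sepC (componentDecomposition isMatroid d C compC)
      (separatorDecomposition isMatroid d (RankStr.E A ─ C) (MatroidProperties.separator-compl isMatroid sepC) (<-wellFounded _))

  cdd≤cd : ∀ {k} {A : RankStr N} → CD k A → CDD k A
  cdd≤cd (cd-empty E≡∅)                  = cdd-empty E≡∅
  cdd≤cd (cd-disconn disconnected d)     = cdd-disconn disconnected (λ C compC → cdd≤cd (d C compC))
  cdd≤cd (cd-conn E≢∅ connected e e∈E d) = cdd-conn E≢∅ connected e e∈E (inj₂ (cdd≤cd d))

  cdd≤dd : ∀ {k} {A : RankStr N} → DD k A → CDD k A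
  cdd≤dd (dd-empty E≡∅)                  = cdd-empty E≡∅
  cdd≤dd (dd-disconn disconnected d)     = cdd-disconn disconnected (λ C compC → cdd≤dd (d C compC))
  cdd≤dd (dd-conn E≢∅ connected e e∈E d) = cdd-conn E≢∅ connected e e∈E (inj₁ (cdd≤dd d))

theorem5p2 : (N : ℕ) (M : Matroid N) (k : ℕ) →
    (CDD k (Matroid.str M) → BD k (Matroid.str M)) ×
    (CD k (Matroid.str M) → CDD k (Matroid.str M)) ×
    (DD k (Matroid.str M) → CDD k (Matroid.str M))
theorem5p2 N M k = branch-depth≤cdd (Matroid.isMatroid M) , cdd≤cd , cdd≤dd
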